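{- Let $k\geq 1$ be an integer. For integers $m_1,\dots,m_k$ and $n\geq 1$, let $\mathcal{U}_k(m_1,\dots,m_k;n)$ denote the number of $k$-marked strongly unimodal symbols of size $n$ whose $j$th rank equals $m_j$ for every $1\leq j\leq k$. Then, as an identity of formal power series in $q$ (with coefficients Laurent polynomials in $x_1,\dots,x_k$), \[ \sum_{m_1,\dots,m_k \in \mathbb{Z}}\ \sum_{n\geq 1} \mathcal{U}_k(m_1, \dots, m_k; n)\, x_1^{m_1}\cdots x_k^{m_k}q^n = U_k(x_1,\dots, x_k; q), \] where \begin{multline*} U_k(x_1,\dots, x_k; q) := \sum_{m_1,\dots, m_k \geq 1} q^{M_1 + \cdots + M_{k}} \prod_{j=1}^{k-1}\left(1+x_j^{ -1}q^{M_j}\right) \\ \cdot (-x_1q;q)_{m_1-1}(-x_1^{ -1}q;q)_{m_1-1}\prod_{j=2}^{k}(-x_jq^{M_{j-1}+1};q)_{m_j-1}(-x_j^{ -1}q^{M_{j-1}+1};q)_{m_j-1}, \end{multline*} with $M_j:= m_1 + m_2 + \cdots + m_j$ for $1\leq j \leq k$ (empty products equal $1$).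
   Context: Notation: $(a;q)_n:=\prod_{i=1}^{n}(1-aq^{i-1})$ for $n\ge 0$ (so $(a;q)_0=1$). A strongly unimodal sequence of size $n$ is a finite list of positive integers $a_1<a_2<\cdots<a_r>a_{r+1}>\cdots>a_s$ summing to $n$; $a_r$ is the peak. Such a sequence is encoded by its strongly unimodal symbol: the peak size $P=a_r$ (written as a subscript), a top row listing the parts to the right of the peak ($a_{r+1}>\cdots>a_s$) and a bottom row listing the parts to the left of the peak in decreasing order ($a_{r-1}>\cdots>a_1$). Thus the symbol consists of $P\ge1$ and two strictly decreasing (possibly empty) sequences of positive integers less than $P$; its size is $P$ plus the sum of all parts in both rows. A $k$-marked strongly unimodal symbol is a strongly unimodal symbol in which every part in both rows carries a subscript (mark) from $\{1,\dots,k\}$ (for $k=1$ all marks are $1$ and there are no further conditions). When $k\geq 2$ the following are additionally required: (1) in each row the parts are strictly decreasing and the subscripts are nonincreasing (reading left to right); (2) in the top row each of $1,2,\dots,k-1$ appears as the subscript of some part; (3) letting $M_j$ be the largest part with subscript $j$ in the top row ($1\le j\le k-1$), $M_0:=0$, and $M_k$ the peak size, all parts in the bottom row with subscript $j\in\{1,\dots,k-1\}$ lie in $[M_{j-1}+1,M_j]$, and those with subscript $k$ lie in $[M_{k-1}+1,M_k-1]$. Ranks: for such a symbol $\gamma$, let $\alpha^j$ and $\beta^j$ be the collections of parts with subscript $j$ in the top and bottom rows respectively, and $\ell(\cdot)$ the number of parts. The $j$th rank is $\rho_j(\gamma)=\ell(\alpha^j)-\ell(\beta^j)-1$ for $j<k$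 and $\rho_k(\gamma)=\ell(\alpha^k)-\ell(\beta^k)$. -}

module Defs where

open import Data.Bool using (Bool; true; false; _∧_; _∨_; if_then_else_; T)
open import Data.Nat using (ℕ; zero; suc; _+_; _∸_; _≤ᵇ_; _<ᵇ_; _≡ᵇ_; _⊔_)
open import Data.Integer using (ℤ; +_; -[1+_]) renaming (_+_ to _+ℤ_; _-_ to _-ℤ_)
import Data.Integer as ℤ
open import Data.Fin using (Fin; toℕ)
open import Data.Product using (_×_; _,_; proj₁; proj₂)
open import Data.List using (List; []; _∷_; _++_; map; foldr; length; concatMap; upTo; allFin; filterᵇ; take)
open import Data.Nat.ListAction using (sum)
open import Data.Bool.ListAction using (all; any)
open import Data.Vec using (Vec; tabulate; replicate; zipWith; lookup; toList)
import Data.Vec as Vec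
open import Data.Vec.Properties using (≡-dec)
open import Relation.Nullary using (does)

-- A part of a row: (part size , mark).  A mark t : Fin k stands for the
-- subscript  mark t = toℕ t + 1 ∈ {1,…,k}.
mark : {k : ℕ} → Fin k → ℕ
mark t = suc (toℕ t)

record Symbol (k : ℕ) : Set where
  constructor symbol
  field
    peak : ℕ
    top  : List (ℕ × Fin k)
    bot  : List (ℕ × Fin k)
open Symbol public

parts : {k : ℕ} → List (ℕ × Fin k) → List ℕ
parts = map proj₁

marks : {k : ℕ} → List (ℕ × Fin k) → List ℕ
marks = map (λ p → mark (proj₂ p))

strictDec : List ℕ → Bool
strictDec [] = true
strictDec (a ∷ []) = true
strictDec (a ∷ b ∷ r) = (b <ᵇ a) ∧ strictDec (b ∷ r)

nonInc : List ℕ → Bool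
nonInc [] = true
nonInc (a ∷ []) = true
nonInc (a ∷ b ∷ r) = (b ≤ᵇ a) ∧ nonInc (b ∷ r)

withMark : {k : ℕ} → ℕ → List (ℕ × Fin k) → List ℕ
withMark j row = parts (filterᵇ (λ p → mark (proj₂ p) ≡ᵇ j) row)

Mtop : {k : ℕ} → Symbol k → ℕ → ℕ
Mtop γ zero = 0
Mtop {k} γ (suc i) =
  if suc i <ᵇ k then foldr _⊔_ 0 (withMark (suc i) (top γ)) else peak γ

basicOK : {k : ℕ} → Symbol k → Bool
basicOK γ =
  (1 ≤ᵇ peak γ)
  ∧ all (λ a → (1 ≤ᵇ a) ∧ (a <ᵇ peak γ)) (parts (top γ))
  ∧ all (λ a → (1 ≤ᵇ a) ∧ (a <ᵇ peak γ)) (parts (bot γ))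
  ∧ strictDec (parts (top γ))
  ∧ strictDec (parts (bot γ))

bottomOK : {k : ℕ} → Symbol k → ℕ × Fin k → Bool
bottomOK {k} γ (b , t) =
  if mark t <ᵇ k
  then (Mtop γ (toℕ t) <ᵇ b) ∧ (b ≤ᵇ Mtop γ (mark t))
  else (Mtop γ (toℕ t) <ᵇ b) ∧ (b <ᵇ Mtop γ (mark t))

extraOK : {k : ℕ} → Symbol k → Bool
extraOK {k} γ =
  nonInc (marks (top γ)) ∧ nonInc (marks (bot γ))
  ∧ all (λ t → if mark t <ᵇ k
               then any (λ p → mark (proj₂ p) ≡ᵇ mark t) (top γ)
               else true) (allFin k)
  ∧ all (bottomOK γ) (bot γ)

valid : {k : ℕ} → Symbol k → Bool
valid {k} γ = basicOK γ ∧ (if 2 ≤ᵇ k then extraOK γ else true)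

size : {k : ℕ} → Symbol k → ℕ
size γ = peak γ + sum (parts (top γ)) + sum (parts (bot γ))

ℓ : {k : ℕ} → ℕ → List (ℕ × Fin k) → ℕ
ℓ j row = length (withMark j row)

rank : {k : ℕ} → Symbol k → Vec ℤ k
rank {k} γ = tabulate λ t →
  ((+ ℓ (mark t) (top γ)) -ℤ (+ ℓ (mark t) (bot γ)))
    -ℤ (if mark t <ᵇ k then + 1 else + 0)

-- Polynomials in q with Laurent-polynomial coefficients in x_1..x_k and
-- natural-number coefficients, represented as formal sums (lists) of
-- monomials x^e q^d, each with coefficient 1 (multiplicity = coefficient).

Mono : ℕ → Set
Mono k = Vec ℤ k × ℕ

Poly : ℕ → Set
Poly k = List (Mono k)

mon : {k : ℕ} → Vec ℤ k → ℕ → Poly k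
mon e d = (e , d) ∷ []

one : {k : ℕ} → Poly k
one {k} = mon (replicate k (+ 0)) 0

infixr 6 _⊕_
infixr 7 _⊗_

_⊕_ : {k : ℕ} → Poly k → Poly k → Poly k
_⊕_ = _++_

_⊗_ : {k : ℕ} → Poly k → Poly k → Poly k
p ⊗ r = concatMap (λ a → map (λ b → zipWith _+ℤ_ (proj₁ a) (proj₁ b) , proj₂ a + proj₂ b) r) p

prodP : {k : ℕ} → List (Poly k) → Poly k
prodP = foldr _⊗_ one

coeff : {k : ℕ} → Vec ℤ k → ℕ → Poly k → ℕ
coeff e d p = length (filterᵇ (λ mo → does (≡-dec ℤ._≟_ (proj₁ mo) e) ∧ (proj₂ mo ≡ᵇ d)) p)

xe : {k : ℕ} → Fin k → ℤ → Vec ℤ k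
xe t s = tabulate (λ i → if toℕ i ≡ᵇ toℕ t then s else + 0)

poch : {k : ℕ} → Vec ℤ k → ℕ → ℕ → Poly k
poch e a m = prodP (map (λ i → one ⊕ mon e (a + i)) (upTo m))

Uterm : (k : ℕ) → Vec ℕ k → Poly k
Uterm k m =
  mon (replicate k (+ 0)) (sum (map (λ t → M (mark t)) (allFin k)))
  ⊗ prodP (map (λ t → if mark t <ᵇ k then one ⊕ mon (xe t -[1+ 0 ]) (M (mark t)) else one)
               (allFin k))
  ⊗ prodP (map (λ t → poch (xe t (+ 1)) (M (toℕ t) + 1) (lookup m t ∸ 1)
                      ⊗ poch (xe t -[1+ 0 ]) (M (toℕ t) + 1) (lookup m t ∸ 1))
               (allFin k))
  where
  M : ℕ → ℕ
  M j = sum (take j (toList m))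

box : (k : ℕ) → ℕ → List (Vec ℕ k)
box zero n = Vec.[] ∷ []
box (suc k) n = concatMap (λ a → map (a Vec.∷_) (box k n)) (map suc (upTo n))

-- The part of the series U_k relevant for the coefficient of q^n:
-- summands with some m_j > n have q-degree ≥ M_1+…+M_k ≥ M_k > n.
Utrunc : (k : ℕ) → ℕ → Poly k
Utrunc k n = concatMap (Uterm k) (box k n)

coeffU : (k : ℕ) → Vec ℤ k → ℕ → ℕ
coeffU k m n = coeff m n (Utrunc k n)

-- Expanding the summand of U_k indexed by m = (m₁,…,m_k) by choosing one term from every binomial
-- factor produces one monomial per choice.  With M_j = m₁ + ⋯ + m_j, such a choice describes a
-- k-marked symbol with peak M_k whose parts of mark j lie in (M_{j-1}, M_j]: the peak and the top
-- parts M_j (j < k) account for q^{M_1+⋯+M_k}; the top row also holds M_{j-1}+1+i whenever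
-- x_j q^{M_{j-1}+1+i} is chosen in (-x_j q^{M_{j-1}+1};q)_{m_j-1}; the bottom row holds M_j when
-- x_j^{-1} q^{M_j} is chosen and M_{j-1}+1+i whenever x_j^{-1} q^{M_{j-1}+1+i} is chosen.  The
-- exponent of x_j is then the j-th rank and that of q the size.  Conversely M_j is the largest top
-- part of mark j, and a row, being a strictly decreasing list, is determined by its set of parts, so
-- a symbol determines its choice.  Hence the coefficient of x^m q^n counts the symbols of size n
-- and rank vector m.

module Submission where

open import Defs
open import Axiom.UniquenessOfIdentityProofs.WithK using (uip)
open import Data.Bool using (Bool; true; false; T; if_then_else_; _∧_; f≤t; b≤b)
open import Data.Bool.ListAction using (all; any)
import Data.Bool as Bool
open import Data.Bool.Properties using (T-irrelevant; T-∧; T-≡)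
open import Data.Empty using (⊥-elim)
open import Data.Fin using (Fin; zero; suc; toℕ; inject₁; fromℕ<)
import Data.Fin as Fin
open import Data.Fin.Properties using (toℕ-injective; toℕ-inject₁; toℕ<n; toℕ-fromℕ<; toℕ-fromℕ)
open import Data.Integer using (ℤ; +_; -[1+_]; -_) renaming (_+_ to _+ℤ_)
import Data.Integer as ℤ
open import Data.List using (List; []; _∷_; foldr; _++_; map; length; concatMap; filterᵇ; applyUpTo; upTo; allFin; tabulate; take)
open import Data.List.Properties using (map-applyUpTo; map-++; map-∘; map-id; length-++)
open import Data.Nat.ListAction using (sum)
open import Data.Nat.ListAction.Properties using (sum-++)
open import Data.List.Membership.Propositional using (_∈_; find)
import Data.List.Membership.DecPropositional as DecMembership
open import Data.List.Membership.Propositional.Properties using (∈-map⁺; ∈-map⁻; ∈-filter⁺; ∈-filter⁻; ∈-allFin; ∈-++⁺ˡ; ∈-++⁺ʳ; ∈-++⁻)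
open import Data.List.Relation.Unary.All using (All; []; _∷_)
import Data.List.Relation.Unary.All as All
import Data.List.Relation.Unary.All.Properties as All
open import Data.List.Relation.Unary.All.Properties using (all⁺; all⁻)
open import Data.List.Relation.Unary.AllPairs using (AllPairs; []; _∷_)
import Data.List.Relation.Unary.AllPairs.Properties as AllPairs
open import Data.List.Relation.Unary.Linked using (Linked; []; [-]; _∷_)
open import Data.List.Relation.Unary.Linked.Properties using (AllPairs⇒Linked; Linked⇒AllPairs)
open import Data.List.Relation.Unary.Any using (Any; here; there)
import Data.List.Relation.Unary.Any as Any
open import Data.List.Relation.Unary.Any.Properties using (Any-cong; map↔; concat↔; pure↔; any⁺; any⁻)
open import Data.Nat using (ℕ; zero; suc; _+_; _∸_; _≡ᵇ_; _<ᵇ_; _≤ᵇ_; _≤_; _<_; _≥_; _>_; _⊔_; z≤n; s≤s; s≤s⁻¹; z<s; _<?_; _≤?_; _≟_)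
open import Data.Nat.Properties using (suc-injective; m≤n+m; m<n⇒0<n∸m; n≮n; ∸-monoˡ-<; ≤∧≢⇒<; m+n∸m≡n; +-cancelˡ-≡; +-identityʳ; +-comm; +-assoc; +-monoʳ-≤; +-monoʳ-<; m<m+n; m≤m+n; <-≤-trans; m+[n∸m]≡n; ≮⇒≥; ≤-refl; <⇒≤; m≤n⇒m<n∨m≡n; ≤-<-trans; ≰⇒>; ≡ᵇ⇒≡; ≡⇒≡ᵇ; <ᵇ⇒<; <⇒<ᵇ; ≤ᵇ⇒≤; ≤⇒≤ᵇ; <-trans; ≤-trans; <-irrefl; <-asym; <⇒≱; ≤-total; ≤-antisym; m≤m⊔n; m≤n⊔m; ⊔-lub; m≥n⇒m⊔n≡m; m≤n⇒m⊔n≡n; ⊔-identityʳ)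
open import Data.Product using (Σ; Σ-syntax; ∃; _×_; _,_; proj₁; proj₂; map₁)
import Data.Product.Properties as Product
open import Data.Product.Function.Dependent.Propositional using (Σ-↔)
open import Data.Sum using (_⊎_; inj₁; inj₂)
open import Data.Unit using (⊤; tt)
open import Data.Vec using (Vec; []; _∷_; replicate; zipWith; lookup; toList)
import Data.Vec as Vec
open import Data.Vec.Properties using (≡-dec; lookup-map; ∷-injectiveˡ; ∷-injectiveʳ; lookup-zipWith; lookup-replicate; lookup∘tabulate; tabulate-cong; tabulate∘lookup)
open import Function using (_∘_; _on_; id; case_of_; _↔_; mk↔ₛ′; Inverse; _⇔_; mk⇔; Equivalence)
open import Function.Properties.Inverse using (↔-refl; ↔-sym; ↔-trans)
open import Function.Properties.Equivalence using () renaming (sym to ⇔-sym; trans to ⇔-trans)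
open import Function.Related.Propositional using (module EquationalReasoning)
open import Function.Related.TypeIsomorphisms using (Σ-assoc)
import Algebra.Properties.CommutativeMonoid.Sum as CommutativeMonoidSum
import Data.Nat.Properties as ℕ
import Data.Integer.Properties as ℤ
import Data.Nat.Tactic.RingSolver as ℕ-Solver
import Data.Integer.Tactic.RingSolver as ℤ-Solver
open import Relation.Nullary using (¬_; Dec; does; yes; no)
open import Relation.Nullary.Decidable using (T?)
open import Level using (0ℓ)
open import Relation.Binary using (Rel; Irreflexive; Asymmetric; DecidableEquality)
open import Relation.Binary.PropositionalEquality using (_≡_; refl; sym; trans; cong; cong₂; subst; subst₂; module ≡-Reasoning)

private variable
  A B C D : Set

≡⇒↔ : {P : A → Set} {x y : A} → x ≡ y → P x ↔ P y
≡⇒↔ refl = ↔-refl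

Any-cong-pointwise : {P Q : A → Set} {xs : List A} → (∀ x → P x ↔ Q x) → Any P xs ↔ Any Q xs
Any-cong-pointwise P↔Q = Any-cong P↔Q ↔-refl

Any-concatMap↔ : {P : B → Set} (f : A → List B) (xs : List A) → Any P (concatMap f xs) ↔ Any (Any P ∘ f) xs
Any-concatMap↔ f xs = ↔-sym (↔-trans map↔ concat↔)

count↔Any : (p : A → Bool) (xs : List A) → Fin (length (filterᵇ p xs)) ↔ Any (T ∘ p) xs
count↔Any p [] = mk↔ₛ′ (λ ()) (λ ()) (λ ()) (λ ())
count↔Any p (x ∷ xs) with p x in px
... | true = mk↔ₛ′ to′ from′ to∘from from∘to
  where
  open Inverse (count↔Any p xs)
  to′ : Fin (suc (length (filterᵇ p xs))) → Any (T ∘ p) (x ∷ xs)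
  to′ zero    = here (subst T (sym px) tt)
  to′ (suc i) = there (to i)
  from′ : Any (T ∘ p) (x ∷ xs) → Fin (suc (length (filterᵇ p xs)))
  from′ (here _)  = zero
  from′ (there a) = suc (from a)
  to∘from : ∀ a → to′ (from′ a) ≡ a
  to∘from (here q)  = cong here (T-irrelevant _ q)
  to∘from (there a) = cong there (strictlyInverseˡ a)
  from∘to : ∀ i → from′ (to′ i) ≡ i
  from∘to zero    = refl
  from∘to (suc i) = cong suc (strictlyInverseʳ i)
... | false = mk↔ₛ′ (there ∘ to) from′ to∘from strictlyInverseʳ
  where
  open Inverse (count↔Any p xs)
  from′ : Any (T ∘ p) (x ∷ xs) → Fin (length (filterᵇ p xs))
  from′ (here q)  = ⊥-elim (subst T px q)
  from′ (there a) = from a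
  to∘from : ∀ a → there (to (from′ a)) ≡ a
  to∘from (here q)  = ⊥-elim (subst T px q)
  to∘from (there a) = cong there (strictlyInverseˡ a)

Any-applyUpTo↔ : {P : A → Set} (f : ℕ → A) (n : ℕ) → Any P (applyUpTo f n) ↔ Σ (Fin n) (P ∘ f ∘ toℕ)
Any-applyUpTo↔ f zero = mk↔ₛ′ (λ ()) (λ ()) (λ ()) (λ ())
Any-applyUpTo↔ {P = P} f (suc n) = mk↔ₛ′ to′ from′ to∘from from∘to
  where
  open Inverse (Any-applyUpTo↔ {P = P} (f ∘ suc) n)
  to′ : Any P (applyUpTo f (suc n)) → Σ (Fin (suc n)) (P ∘ f ∘ toℕ)
  to′ (here p)  = zero , p
  to′ (there a) = suc (proj₁ (to a)) , proj₂ (to a)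
  from′ : Σ (Fin (suc n)) (P ∘ f ∘ toℕ) → Any P (applyUpTo f (suc n))
  from′ (zero , p)  = here p
  from′ (suc i , p) = there (from (i , p))
  to∘from : ∀ ip → to′ (from′ ip) ≡ ip
  to∘from (zero , p)  = refl
  to∘from (suc i , p) = cong (λ (jq : Σ (Fin n) (P ∘ f ∘ suc ∘ toℕ)) → suc (proj₁ jq) , proj₂ jq) (strictlyInverseˡ (i , p))
  from∘to : ∀ a → from′ (to′ a) ≡ a
  from∘to (here p)  = refl
  from∘to (there a) = cong there (strictlyInverseʳ a)

All-[]↔⊤ : {P : A → Set} → All P [] ↔ ⊤
All-[]↔⊤ = mk↔ₛ′ (λ _ → tt) (λ _ → []) (λ _ → refl) (λ { [] → refl })

All-∷↔× : {P : A → Set} {x : A} {xs : List A} → All P (x ∷ xs) ↔ (P x × All P xs)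
All-∷↔× = mk↔ₛ′ (λ { (p ∷ ps) → p , ps }) (λ (p , ps) → p ∷ ps) (λ _ → refl) (λ { (p ∷ ps) → refl })

Vec-[]↔⊤ : Vec A 0 ↔ ⊤
Vec-[]↔⊤ = mk↔ₛ′ (λ _ → tt) (λ _ → []) (λ _ → refl) (λ { [] → refl })

Vec-∷↔× : {n : ℕ} → Vec A (suc n) ↔ (A × Vec A n)
Vec-∷↔× = mk↔ₛ′ (λ { (a ∷ as) → a , as }) (λ (a , as) → a ∷ as) (λ _ → refl) (λ { (a ∷ as) → refl })

does-≡ : {P : Set} (P? : Dec P) {b : Bool} → (P → T b) → (T b → P) → does P? ≡ b
does-≡ (yes p) {true}  _   _   = refl
does-≡ (yes p) {false} P⇒b _   = ⊥-elim (P⇒b p)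
does-≡ (no ¬p) {true}  _   b⇒P = ⊥-elim (¬p (b⇒P tt))
does-≡ (no ¬p) {false} _   _   = refl

Vec-≡ : {n : ℕ} {u v : Vec A n} → (∀ i → lookup u i ≡ lookup v i) → u ≡ v
Vec-≡ {u = u} {v} u≗v = trans (sym (tabulate∘lookup u)) (trans (tabulate-cong u≗v) (tabulate∘lookup v))

All-tabulate⁻∘⁺ : {n : ℕ} {f : Fin n → A} {P : A → Set} (g : ∀ i → P (f i)) (i : Fin n) →
  All.tabulate⁻ (All.tabulate⁺ {P = P} g) i ≡ g i
All-tabulate⁻∘⁺ {n = suc n} g zero    = refl
All-tabulate⁻∘⁺ {n = suc n} g (suc i) = All-tabulate⁻∘⁺ (g ∘ suc) i

All-tabulate⁻-injective : {n : ℕ} {f : Fin n → A} {P : A → Set} (a b : All P (tabulate f)) →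
  (∀ i → All.tabulate⁻ a i ≡ All.tabulate⁻ b i) → a ≡ b
All-tabulate⁻-injective {n = zero}  []       []       _   = refl
All-tabulate⁻-injective {n = suc n} (p ∷ ps) (q ∷ qs) a≗b = cong₂ _∷_ (a≗b zero) (All-tabulate⁻-injective ps qs (a≗b ∘ suc))

<⇒<ᵇ≡true : ∀ {m n} → m < n → (m <ᵇ n) ≡ true
<⇒<ᵇ≡true = Equivalence.to T-≡ ∘ <⇒<ᵇ

strictDec⇔AllPairs> : (xs : List ℕ) → T (strictDec xs) ⇔ AllPairs _>_ xs
strictDec⇔AllPairs> xs = mk⇔ (Linked⇒AllPairs (λ y<x z<y → <-trans z<y y<x) ∘ to xs) (from xs ∘ AllPairs⇒Linked)
  where
  to : ∀ xs → T (strictDec xs) → Linked _>_ xs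
  to []           _ = []
  to (x ∷ [])     _ = [-]
  to (x ∷ y ∷ xs) q = <ᵇ⇒< y x (proj₁ (Equivalence.to T-∧ q)) ∷ to (y ∷ xs) (proj₂ (Equivalence.to T-∧ q))
  from : ∀ xs → Linked _>_ xs → T (strictDec xs)
  from []           _            = tt
  from (x ∷ [])     _            = tt
  from (x ∷ y ∷ xs) (y<x ∷ rest) = Equivalence.from T-∧ (<⇒<ᵇ y<x , from (y ∷ xs) rest)

nonInc⇔AllPairs≥ : (xs : List ℕ) → T (nonInc xs) ⇔ AllPairs _≥_ xs
nonInc⇔AllPairs≥ xs = mk⇔ (Linked⇒AllPairs (λ y≤x z≤y → ≤-trans z≤y y≤x) ∘ to xs) (from xs ∘ AllPairs⇒Linked)
  where
  to : ∀ xs → T (nonInc xs) → Linked _≥_ xs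
  to []           _ = []
  to (x ∷ [])     _ = [-]
  to (x ∷ y ∷ xs) q = ≤ᵇ⇒≤ y x (proj₁ (Equivalence.to T-∧ q)) ∷ to (y ∷ xs) (proj₂ (Equivalence.to T-∧ q))
  from : ∀ xs → Linked _≥_ xs → T (nonInc xs)
  from []           _            = tt
  from (x ∷ [])     _            = tt
  from (x ∷ y ∷ xs) (y≤x ∷ rest) = Equivalence.from T-∧ (≤⇒≤ᵇ y≤x , from (y ∷ xs) rest)

AllPairs-unique : {R : Rel A 0ℓ} → Irreflexive _≡_ R → Asymmetric R → {xs ys : List A} →
  AllPairs R xs → AllPairs R ys → (∀ {z} → z ∈ xs → z ∈ ys) → (∀ {z} → z ∈ ys → z ∈ xs) → xs ≡ ys
AllPairs-unique irr asym {[]} {[]} _ _ _ _ = refl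
AllPairs-unique irr asym {[]} {y ∷ ys} _ _ _ ys⊆xs with () ← ys⊆xs (here refl)
AllPairs-unique irr asym {x ∷ xs} {[]} _ _ xs⊆ys _ with () ← xs⊆ys (here refl)
AllPairs-unique {R = R} irr asym {x ∷ xs} {y ∷ ys} (x≻ ∷ xs-sorted) (y≻ ∷ ys-sorted) xs⊆ys ys⊆xs
  with heads-equal
  where
  heads-equal : x ≡ y
  heads-equal with xs⊆ys (here refl) | ys⊆xs (here refl)
  ... | here x≡y   | _          = x≡y
  ... | there _    | here y≡x   = sym y≡x
  ... | there x∈ys | there y∈xs = ⊥-elim (asym (All.lookup y≻ x∈ys) (All.lookup x≻ y∈xs))
... | refl = cong (x ∷_) (AllPairs-unique irr asym xs-sorted ys-sorted (tail x≻ xs⊆ys) (tail y≻ ys⊆xs))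
  where
  tail : ∀ {us vs} → All (R x) us → (∀ {z} → z ∈ x ∷ us → z ∈ x ∷ vs) → ∀ {z} → z ∈ us → z ∈ vs
  tail x≻us sub z∈us with sub (there z∈us)
  ... | here refl  = ⊥-elim (irr refl (All.lookup x≻us z∈us))
  ... | there z∈vs = z∈vs

≤-maximum : ∀ {x} xs → x ∈ xs → x ≤ foldr _⊔_ 0 xs
≤-maximum (y ∷ xs) (here refl) = m≤m⊔n y _
≤-maximum (y ∷ xs) (there x∈xs) = ≤-trans (≤-maximum xs x∈xs) (m≤n⊔m y _)

maximum-≤ : ∀ {z} xs → (∀ {x} → x ∈ xs → x ≤ z) → foldr _⊔_ 0 xs ≤ z
maximum-≤ []       _  = z≤n
maximum-≤ (y ∷ xs) ≤z = ⊔-lub (≤z (here refl)) (maximum-≤ xs (≤z ∘ there))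

maximum-∈ : ∀ {x} xs → x ∈ xs → foldr _⊔_ 0 xs ∈ xs
maximum-∈ (y ∷ xs) _ with ≤-total (foldr _⊔_ 0 xs) y
... | inj₁ max≤y = here (m≥n⇒m⊔n≡m max≤y)
maximum-∈ (y ∷ [])     _ | inj₂ _    = here (⊔-identityʳ y)
maximum-∈ (y ∷ z ∷ xs) _ | inj₂ y≤max = there (subst (_∈ z ∷ xs) (sym (m≤n⇒m⊔n≡n y≤max)) (maximum-∈ (z ∷ xs) (here refl)))

maximum-≡ : ∀ {z} xs → z ∈ xs → (∀ {x} → x ∈ xs → x ≤ z) → foldr _⊔_ 0 xs ≡ z
maximum-≡ xs z∈xs ≤z = ≤-antisym (maximum-≤ xs ≤z) (≤-maximum xs z∈xs)

-- g a < g b forces b to precede a in the list, hence f b > f a.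
<-reflects-position : (f g : A → ℕ) {xs : List A} → AllPairs (_>_ on f) xs → AllPairs (_≥_ on g) xs →
  ∀ {a b} → a ∈ xs → b ∈ xs → g a < g b → f a < f b
<-reflects-position f g (_ ∷ _) (g≥ ∷ _) (here refl) (there b∈xs) ga<gb = ⊥-elim (<⇒≱ ga<gb (All.lookup g≥ b∈xs))
<-reflects-position f g (_ ∷ _) (_ ∷ _) (here refl) (here refl) ga<ga = ⊥-elim (<-irrefl refl ga<ga)
<-reflects-position f g (f> ∷ _) (_ ∷ _) (there a∈xs) (here refl) _ = All.lookup f> a∈xs
<-reflects-position f g (_ ∷ f-sorted) (_ ∷ g-sorted) (there a∈xs) (there b∈xs) ga<gb =
  <-reflects-position f g f-sorted g-sorted a∈xs b∈xs ga<gb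

AllPairs≥-of-monotone : (f g : A → ℕ) {xs : List A} → AllPairs (_>_ on f) xs →
  (∀ {a b} → a ∈ xs → b ∈ xs → f a < f b → g a ≤ g b) → AllPairs (_≥_ on g) xs
AllPairs≥-of-monotone f g [] mono = []
AllPairs≥-of-monotone f g (f> ∷ f-sorted) mono =
  All.tabulate (λ a∈xs → mono (there a∈xs) (here refl) (All.lookup f> a∈xs))
  ∷ AllPairs≥-of-monotone f g f-sorted (λ a∈ b∈ → mono (there a∈) (there b∈))

-- Formal sums of monomials

OptionalBit : Bool → Set
OptionalBit c = Σ[ b ∈ Bool ] b Bool.≤ c

module _ {k : ℕ} where

  infixl 7 _∙_
  _∙_ : Mono k → Mono k → Mono k
  a ∙ b = zipWith _+ℤ_ (proj₁ a) (proj₁ b) , proj₂ a + proj₂ b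

  ε : Mono k
  ε = replicate k (+ 0) , 0

  -- As multisets, p = { w c | c : C }.
  _IsSumOver_ : Poly k → (C → Mono k) → Set₁
  p IsSumOver w = ∀ {P : Mono k → Set} → Any P p ↔ ∃ (P ∘ w)

  sum-reindex : {p : Poly k} {w : C → Mono k} {w′ : D → Mono k} (e : D ↔ C) →
    (∀ d → w (Inverse.to e d) ≡ w′ d) → p IsSumOver w → p IsSumOver w′
  sum-reindex e w≡w′ p-sum {P} = ↔-trans (p-sum {P}) (↔-sym (Σ-↔ e (λ {d} → ≡⇒↔ {P = P} (sym (w≡w′ d)))))

  mon-sum : (e : Vec ℤ k) (d : ℕ) → mon e d IsSumOver (λ (_ : ⊤) → (e , d))
  mon-sum e d {P} = ↔-trans (↔-sym (pure↔ {P = P})) (mk↔ₛ′ (tt ,_) proj₂ (λ _ → refl) (λ _ → refl))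

  bit : Vec ℤ k → ℕ → Bool → Mono k
  bit e d b = if b then (e , d) else ε

  binomial-sum : (e : Vec ℤ k) (d : ℕ) → (one ⊕ mon e d) IsSumOver bit e d
  binomial-sum e d {P} = mk↔ₛ′ to from to∘from from∘to
    where
    to : Any P (one ⊕ mon e d) → ∃ (P ∘ bit e d)
    to (here p)         = false , p
    to (there (here p)) = true , p
    from : ∃ (P ∘ bit e d) → Any P (one ⊕ mon e d)
    from (false , p) = here p
    from (true , p)  = there (here p)
    to∘from : (bp : ∃ (P ∘ bit e d)) → to (from bp) ≡ bp
    to∘from (false , p) = refl
    to∘from (true , p)  = refl
    from∘to : (a : Any P (one ⊕ mon e d)) → from (to a) ≡ a
    from∘to (here p)         = refl
    from∘to (there (here p)) = refl

  optional-binomial-sum : (c : Bool) (e : Vec ℤ k) (d : ℕ) →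
    (if c then one ⊕ mon e d else one) IsSumOver (bit e d ∘ proj₁ {B = λ b → b Bool.≤ c})
  optional-binomial-sum true e d = sum-reindex (mk↔ₛ′ proj₁ toBit (λ { false → refl ; true → refl }) fromBit∘to)
      (λ _ → refl) (binomial-sum e d)
    where
    toBit : Bool → OptionalBit true
    toBit false = false , f≤t
    toBit true  = true , b≤b
    fromBit∘to : ∀ b → toBit (proj₁ b) ≡ b
    fromBit∘to (false , f≤t) = refl
    fromBit∘to (true , b≤b)  = refl
  optional-binomial-sum false e d = sum-reindex (mk↔ₛ′ (λ _ → tt) (λ _ → false , b≤b) (λ _ → refl) only-false)
      (λ { (false , b≤b) → refl }) (mon-sum _ 0)
    where
    only-false : ∀ b → (false , b≤b) ≡ b
    only-false (false , b≤b) = refl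

  ⊗-sum : {p q : Poly k} {w : C → Mono k} {v : D → Mono k} →
    p IsSumOver w → q IsSumOver v → (p ⊗ q) IsSumOver (λ (cd : C × D) → w (proj₁ cd) ∙ v (proj₂ cd))
  ⊗-sum {p = p} {q} {w} {v} p-sum q-sum {P} = begin
    Any P (p ⊗ q)                        ↔⟨ Any-concatMap↔ _ p ⟩
    Any (λ a → Any P (map (a ∙_) q)) p   ↔⟨ Any-cong-pointwise (λ a → ↔-sym map↔) ⟩
    Any (λ a → Any (P ∘ (a ∙_)) q) p     ↔⟨ Any-cong-pointwise (λ a → q-sum) ⟩
    Any (λ a → ∃ λ d → P (a ∙ v d)) p    ↔⟨ p-sum ⟩
    (∃ λ c → ∃ λ d → P (w c ∙ v d))      ↔⟨ ↔-sym Σ-assoc ⟩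
    (∃ λ cd → P (w (proj₁ cd) ∙ v (proj₂ cd)))  ∎
    where open EquationalReasoning

  ∏ : {xs : List A} {C : A → Set} → (∀ x → C x → Mono k) → All C xs → Mono k
  ∏ w []       = ε
  ∏ w (c ∷ cs) = w _ c ∙ ∏ w cs

  prodP-sum : {C : A → Set} (f : A → Poly k) (w : ∀ x → C x → Mono k) →
    (∀ x → f x IsSumOver w x) → (xs : List A) → prodP (map f xs) IsSumOver ∏ {xs = xs} w
  prodP-sum f w f-sum [] =
    sum-reindex All-[]↔⊤ (λ { [] → refl }) (mon-sum _ 0)
  prodP-sum f w f-sum (x ∷ xs) =
    sum-reindex All-∷↔× (λ { (c ∷ cs) → refl }) (⊗-sum (f-sum x) (prodP-sum f w f-sum xs))

  ∏ᵛ : {L : ℕ} → (ℕ → C → Mono k) → Vec C L → Mono k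
  ∏ᵛ w []       = ε
  ∏ᵛ w (c ∷ cs) = w 0 c ∙ ∏ᵛ (w ∘ suc) cs

  prodP-applyUpTo-sum : (G : ℕ → Poly k) (w : ℕ → C → Mono k) → (∀ i → G i IsSumOver w i) →
    ∀ L → prodP (applyUpTo G L) IsSumOver ∏ᵛ {L = L} w
  prodP-applyUpTo-sum G w G-sum zero =
    sum-reindex Vec-[]↔⊤ (λ { [] → refl }) (mon-sum _ 0)
  prodP-applyUpTo-sum G w G-sum (suc L) =
    sum-reindex Vec-∷↔× (λ { (c ∷ cs) → refl }) (⊗-sum (G-sum 0) (prodP-applyUpTo-sum (G ∘ suc) (w ∘ suc) (G-sum ∘ suc) L))

  pochWeight : Vec ℤ k → (ℕ → ℕ) → {L : ℕ} → Vec Bool L → Mono k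
  pochWeight e f = ∏ᵛ (λ i → bit e (f i))

  poch-sum : (e : Vec ℤ k) (a L : ℕ) → poch e a L IsSumOver pochWeight e (λ i → a + i) {L}
  poch-sum e a L = subst (_IsSumOver pochWeight e (λ i → a + i))
    (sym (cong prodP (map-applyUpTo id (λ i → one ⊕ mon e (a + i)) L)))
    (prodP-applyUpTo-sum _ _ (λ i → binomial-sum e (a + i)) L)

  M : Vec ℕ k → ℕ → ℕ
  M m j = sum (take j (toList m))

  BlockBits : Vec ℕ k → Fin k → Set
  BlockBits m t = Vec Bool (lookup m t ∸ 1) × Vec Bool (lookup m t ∸ 1)

  Choice : Vec ℕ k → Set
  Choice m = All (λ t → OptionalBit (mark t <ᵇ k)) (allFin k) × All (BlockBits m) (allFin k)

  bitWeight : (m : Vec ℕ k) (t : Fin k) → OptionalBit (mark t <ᵇ k) → Mono k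
  bitWeight m t b = bit (xe t -[1+ 0 ]) (M m (mark t)) (proj₁ b)

  blockWeight : (m : Vec ℕ k) (t : Fin k) → BlockBits m t → Mono k
  blockWeight m t vw = pochWeight (xe t (+ 1)) (λ i → M m (toℕ t) + 1 + i) (proj₁ vw)
                     ∙ pochWeight (xe t -[1+ 0 ]) (λ i → M m (toℕ t) + 1 + i) (proj₂ vw)

  termWeight : (m : Vec ℕ k) → Choice m → Mono k
  termWeight m (bs , vs) =
    (replicate k (+ 0) , sum (map (λ t → M m (mark t)) (allFin k))) ∙ (∏ (bitWeight m) bs ∙ ∏ (blockWeight m) vs)

  Uterm-sum : (m : Vec ℕ k) → Uterm k m IsSumOver termWeight m
  Uterm-sum m = sum-reindex (mk↔ₛ′ (tt ,_) proj₂ (λ _ → refl) (λ _ → refl)) (λ _ → refl)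
    (⊗-sum (mon-sum _ _)
      (⊗-sum (prodP-sum (λ t → if mark t <ᵇ k then one ⊕ mon (xe t -[1+ 0 ]) (M m (mark t)) else one) (bitWeight m)
                        (λ t → optional-binomial-sum (mark t <ᵇ k) (xe t -[1+ 0 ]) (M m (mark t))) (allFin k))
             (prodP-sum (λ t → poch (xe t (+ 1)) (M m (toℕ t) + 1) (lookup m t ∸ 1)
                               ⊗ poch (xe t -[1+ 0 ]) (M m (toℕ t) + 1) (lookup m t ∸ 1)) (blockWeight m)
                        (λ t → ⊗-sum (poch-sum _ _ _) (poch-sum _ _ _)) (allFin k))))

gaps : {k n : ℕ} → Vec (Fin n) k → Vec ℕ k
gaps = Vec.map (suc ∘ toℕ)

Any-box↔ : (k n : ℕ) {Q : Vec ℕ k → Set} → Any Q (box k n) ↔ Σ (Vec (Fin n) k) (Q ∘ gaps)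
Any-box↔ zero n {Q} = ↔-trans (↔-sym (pure↔ {P = Q})) (mk↔ₛ′ ([] ,_) (λ { ([] , q) → q }) (λ { ([] , q) → refl }) (λ _ → refl))
Any-box↔ (suc k) n {Q} = begin
  Any Q (box (suc k) n)                                              ↔⟨ Any-concatMap↔ _ (map suc (upTo n)) ⟩
  Any (λ a → Any Q (map (a ∷_) (box k n))) (map suc (upTo n))       ↔⟨ Any-cong-pointwise (λ a → ↔-sym map↔) ⟩
  Any (λ a → Any (Q ∘ (a ∷_)) (box k n)) (map suc (upTo n))         ↔⟨ Any-cong-pointwise (λ a → Any-box↔ k n) ⟩
  Any (λ a → Σ (Vec (Fin n) k) (λ v → Q (a ∷ gaps v))) (map suc (upTo n))  ↔⟨ ↔-sym map↔ ⟩
  Any (λ a → Σ (Vec (Fin n) k) (λ v → Q (suc a ∷ gaps v))) (upTo n)  ↔⟨ Any-applyUpTo↔ id n ⟩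
  Σ (Fin n) (λ i → Σ (Vec (Fin n) k) (λ v → Q (suc (toℕ i) ∷ gaps v))) ↔⟨ ↔-sym Σ-assoc ⟩
  Σ (Fin n × Vec (Fin n) k) (λ iv → Q (gaps (proj₁ iv ∷ proj₂ iv)))  ↔⟨ Σ-↔ (↔-sym Vec-∷↔×) ↔-refl ⟩
  Σ (Vec (Fin n) (suc k)) (Q ∘ gaps)                                 ∎
  where open EquationalReasoning

module _ {k : ℕ} where

  Utrunc-sum : (n : ℕ) → Utrunc k n IsSumOver (λ (vc : Σ (Vec (Fin n) k) (Choice ∘ gaps)) → termWeight (gaps (proj₁ vc)) (proj₂ vc))
  Utrunc-sum n {P} = begin
    Any P (Utrunc k n)                                        ↔⟨ Any-concatMap↔ (Uterm k) (box k n) ⟩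
    Any (Any P ∘ Uterm k) (box k n)                           ↔⟨ Any-box↔ k n ⟩
    Σ (Vec (Fin n) k) (λ v → Any P (Uterm k (gaps v)))        ↔⟨ Σ-↔ ↔-refl (Uterm-sum _) ⟩
    Σ (Vec (Fin n) k) (λ v → ∃ (P ∘ termWeight (gaps v)))     ↔⟨ ↔-sym Σ-assoc ⟩
    ∃ (λ (vc : Σ (Vec (Fin n) k) (Choice ∘ gaps)) → P (termWeight (gaps (proj₁ vc)) (proj₂ vc))) ∎
    where open EquationalReasoning

  coeffTest↔≡ : (e : Vec ℤ k) (d : ℕ) (mo : Mono k) →
    T (does (≡-dec ℤ._≟_ (proj₁ mo) e) ∧ (proj₂ mo ≡ᵇ d)) ↔ (mo ≡ (e , d))
  coeffTest↔≡ e d (e′ , d′) with ≡-dec ℤ._≟_ e′ e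
  ... | no e′≢e  = mk↔ₛ′ (λ ()) (λ { refl → e′≢e refl }) (λ { refl → ⊥-elim (e′≢e refl) }) (λ ())
  ... | yes refl = mk↔ₛ′ (λ q → cong (e ,_) (≡ᵇ⇒≡ d′ d q)) (λ { refl → ≡⇒≡ᵇ d d refl })
                         (λ _ → uip _ _) (λ _ → T-irrelevant _ _)

  coeff↔ : (e : Vec ℤ k) (d : ℕ) (p : Poly k) {C : Set} {w : C → Mono k} → p IsSumOver w →
    Fin (coeff e d p) ↔ Σ C (λ c → w c ≡ (e , d))
  coeff↔ e d p p-sum = ↔-trans (count↔Any _ p) (↔-trans (Any-cong-pointwise (coeffTest↔≡ e d)) p-sum)

-- Valid symbols

module _ {k : ℕ} where

  mark-injective : {t u : Fin k} → mark t ≡ mark u → t ≡ u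
  mark-injective = toℕ-injective ∘ suc-injective

  ∈-withMark⁻ : ∀ {j x} (row : List (ℕ × Fin k)) → x ∈ withMark j row → ∃ λ t → (x , t) ∈ row × mark t ≡ j
  ∈-withMark⁻ {j} row x∈ with ∈-map⁻ proj₁ x∈
  ... | (_ , t) , xt∈ , refl with ∈-filter⁻ (T? ∘ (λ p → mark (proj₂ p) ≡ᵇ j)) {xs = row} xt∈
  ...   | xt∈row , marked = t , xt∈row , ≡ᵇ⇒≡ (mark t) j marked

  ∈-withMark⁺ : ∀ {j x t} (row : List (ℕ × Fin k)) → (x , t) ∈ row → mark t ≡ j → x ∈ withMark j row
  ∈-withMark⁺ {j} {t = t} row xt∈ t≡j = ∈-map⁺ proj₁ (∈-filter⁺ (T? ∘ _) xt∈ (≡⇒≡ᵇ (mark t) j t≡j))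

  Mtop-inner : (γ : Symbol k) (i : ℕ) → suc i < k → Mtop γ (suc i) ≡ foldr _⊔_ 0 (withMark (suc i) (top γ))
  Mtop-inner γ i i<k with suc i <ᵇ k in eq
  ... | true  = refl
  ... | false = ⊥-elim (subst T eq (<⇒<ᵇ i<k))

  Mtop-last : (γ : Symbol k) (i : ℕ) → ¬ suc i < k → Mtop γ (suc i) ≡ peak γ
  Mtop-last γ i i≮k with suc i <ᵇ k in eq
  ... | true  = ⊥-elim (i≮k (<ᵇ⇒< (suc i) k (subst T (sym eq) tt)))
  ... | false = refl

  record Unimodal (γ : Symbol k) : Set where
    field
      peak-positive  : 1 ≤ peak γ
      top-bounds     : ∀ {x t} → (x , t) ∈ top γ → 1 ≤ x × x < peak γ
      bot-bounds     : ∀ {x t} → (x , t) ∈ bot γ → 1 ≤ x × x < peak γ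
      top-decreasing : AllPairs (_>_ on proj₁) (top γ)
      bot-decreasing : AllPairs (_>_ on proj₁) (bot γ)

  -- For the mark j = mark t, Mtop γ (toℕ t) and Mtop γ (mark t) are M_{j-1} and M_j.
  record Marked (γ : Symbol k) : Set where
    field
      top-range : ∀ {x t} → (x , t) ∈ top γ → Mtop γ (toℕ t) < x × x ≤ Mtop γ (mark t)
      top-max   : ∀ t → mark t < k → (Mtop γ (mark t) , t) ∈ top γ
      bot-range : ∀ {x t} → (x , t) ∈ bot γ → Mtop γ (toℕ t) < x × x ≤ Mtop γ (mark t)

  basicOK⇔Unimodal : (γ : Symbol k) → T (basicOK γ) ⇔ Unimodal γ
  basicOK⇔Unimodal γ = mk⇔ to from
    where
    inRange : ℕ → Bool
    inRange a = (1 ≤ᵇ a) ∧ (a <ᵇ peak γ)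
    bounds⁺ : (row : List (ℕ × Fin k)) → T (all inRange (parts row)) → ∀ {x t} → (x , t) ∈ row → 1 ≤ x × x < peak γ
    bounds⁺ row q xt∈ with Equivalence.to T-∧ (All.lookup (all⁺ inRange _ q) (∈-map⁺ proj₁ xt∈))
    ... | 1≤x , x<P = ≤ᵇ⇒≤ 1 _ 1≤x , <ᵇ⇒< _ (peak γ) x<P
    bounds⁻ : (row : List (ℕ × Fin k)) → (∀ {x t} → (x , t) ∈ row → 1 ≤ x × x < peak γ) → T (all inRange (parts row))
    bounds⁻ row h = all⁻ inRange (All.tabulate in-range)
      where
      in-range : ∀ {x} → x ∈ parts row → T (inRange x)
      in-range x∈ with ∈-map⁻ proj₁ x∈
      ... | _ , xt∈ , refl = Equivalence.from T-∧ (≤⇒≤ᵇ (proj₁ (h xt∈)) , <⇒<ᵇ (proj₂ (h xt∈)))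
    decreasing⁺ : (row : List (ℕ × Fin k)) → T (strictDec (parts row)) → AllPairs (_>_ on proj₁) row
    decreasing⁺ row = AllPairs.map⁻ ∘ Equivalence.to (strictDec⇔AllPairs> (parts row))
    decreasing⁻ : (row : List (ℕ × Fin k)) → AllPairs (_>_ on proj₁) row → T (strictDec (parts row))
    decreasing⁻ row = Equivalence.from (strictDec⇔AllPairs> (parts row)) ∘ AllPairs.map⁺
    to : T (basicOK γ) → Unimodal γ
    to q with Equivalence.to T-∧ q
    ... | P≥1 , q₁ with Equivalence.to T-∧ q₁
    ... | top-in , q₂ with Equivalence.to T-∧ q₂
    ... | bot-in , q₃ with Equivalence.to T-∧ q₃
    ... | top-dec , bot-dec = record
      { peak-positive  = ≤ᵇ⇒≤ 1 (peak γ) P≥1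
      ; top-bounds     = bounds⁺ (top γ) top-in
      ; bot-bounds     = bounds⁺ (bot γ) bot-in
      ; top-decreasing = decreasing⁺ (top γ) top-dec
      ; bot-decreasing = decreasing⁺ (bot γ) bot-dec
      }
    from : Unimodal γ → T (basicOK γ)
    from U = Equivalence.from T-∧ (≤⇒≤ᵇ peak-positive , Equivalence.from T-∧ (bounds⁻ (top γ) top-bounds ,
             Equivalence.from T-∧ (bounds⁻ (bot γ) bot-bounds ,
             Equivalence.from T-∧ (decreasing⁻ (top γ) top-decreasing , decreasing⁻ (bot γ) bot-decreasing))))
      where open Unimodal U

  TopMax : Symbol k → Set
  TopMax γ = ∀ t → mark t < k → (Mtop γ (mark t) , t) ∈ top γ

  InRanges : Symbol k → List (ℕ × Fin k) → Set
  InRanges γ row = ∀ {x t} → (x , t) ∈ row → Mtop γ (toℕ t) < x × x ≤ Mtop γ (mark t)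

  Mtop-previous : (γ : Symbol k) → TopMax γ → (t : Fin k) → 0 < toℕ t →
    ∃ λ u → (Mtop γ (toℕ t) , u) ∈ top γ × mark u ≡ toℕ t
  Mtop-previous γ top-max (suc t) _ =
    inject₁ t , subst (λ j → (Mtop γ j , inject₁ t) ∈ top γ) mark≡ (top-max (inject₁ t) (subst (_< k) (sym mark≡) (toℕ<n (suc t)))) , mark≡
    where
    mark≡ : mark (inject₁ t) ≡ toℕ (suc t)
    mark≡ = cong suc (toℕ-inject₁ t)

  module _ {γ : Symbol k} (U : Unimodal γ) (top-max : TopMax γ) (top-range : InRanges γ (top γ)) where
    open Unimodal U

    Mtop-step : ∀ t → Mtop γ (toℕ t) < Mtop γ (mark t)
    Mtop-step t with mark t <? k
    ... | yes t<k = proj₁ (top-range (top-max t t<k))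
    ... | no  t≮k = subst (Mtop γ (toℕ t) <_) (sym (Mtop-last γ (toℕ t) t≮k)) (below-peak t)
      where
      below-peak : ∀ t → Mtop γ (toℕ t) < peak γ
      below-peak zero    = peak-positive
      below-peak (suc t) = proj₂ (top-bounds (proj₁ (proj₂ (Mtop-previous γ top-max (suc t) z<s))))

    Mtop-mono : ∀ {i j} → i ≤ j → j ≤ k → Mtop γ i ≤ Mtop γ j
    Mtop-mono {i} {zero}  z≤n _   = ≤-refl
    Mtop-mono {i} {suc j} i≤j j<k with m≤n⇒m<n∨m≡n i≤j
    ... | inj₂ refl = ≤-refl
    ... | inj₁ i<sj = ≤-trans (Mtop-mono (s≤s⁻¹ i<sj) (<⇒≤ j<k))
                              (<⇒≤ (subst₂ (λ a b → Mtop γ a < Mtop γ (suc b)) (toℕ-fromℕ< j<k) (toℕ-fromℕ< j<k) (Mtop-step (fromℕ< j<k))))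

    InRanges⇒marks-AllPairs≥ : {row : List (ℕ × Fin k)} → AllPairs (_>_ on proj₁) row → InRanges γ row →
      AllPairs (_≥_ on (mark ∘ proj₂)) row
    InRanges⇒marks-AllPairs≥ sorted ranges = AllPairs≥-of-monotone proj₁ (mark ∘ proj₂) sorted marks-ordered
      where
      marks-ordered : ∀ {a b} → a ∈ _ → b ∈ _ → proj₁ a < proj₁ b → mark (proj₂ a) ≤ mark (proj₂ b)
      marks-ordered {xa , ta} {xb , tb} a∈ b∈ xa<xb with mark ta ≤? mark tb
      ... | yes ta≤tb = ta≤tb
      ... | no  ta≰tb = ⊥-elim (<-asym xa<xb (≤-<-trans (proj₂ (ranges b∈))
                          (≤-<-trans (Mtop-mono (s≤s⁻¹ (≰⇒> ta≰tb)) (<⇒≤ (toℕ<n ta))) (proj₁ (ranges a∈)))))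

  hasMark : Symbol k → Fin k → Bool
  hasMark γ t = if mark t <ᵇ k then any (λ p → mark (proj₂ p) ≡ᵇ mark t) (top γ) else true

  extraOK⇒Marked : {γ : Symbol k} → Unimodal γ → T (extraOK γ) → Marked γ
  extraOK⇒Marked {γ} U q with Equivalence.to (T-∧ {nonInc (marks (top γ))}) q
  ... | top-marks , q₁ with Equivalence.to (T-∧ {all (hasMark γ) (allFin k)}) (proj₂ (Equivalence.to (T-∧ {nonInc (marks (bot γ))}) q₁))
  ... | hits , bottoms-ok = record { top-range = top-range ; top-max = top-max ; bot-range = bot-range }
    where
    open Unimodal U
    top-max : TopMax γ
    top-max t t<k with mark t <ᵇ k in eq | All.lookup (all⁺ (hasMark γ) _ hits) (∈-allFin t)
    ... | false | _ = ⊥-elim (subst T eq (<⇒<ᵇ t<k))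
    ... | true  | has-t with find (any⁻ _ (top γ) has-t)
    ... | (x , u) , xu∈ , u≡t with ∈-withMark⁻ (top γ) (maximum-∈ _ (∈-withMark⁺ (top γ) xu∈ (≡ᵇ⇒≡ (mark u) (mark t) u≡t)))
    ... | v , max-v∈ , v≡t rewrite Mtop-inner γ (toℕ t) t<k = subst (λ w → (_ , w) ∈ top γ) (mark-injective v≡t) max-v∈
    top-range : InRanges γ (top γ)
    top-range {x} {t} xt∈ = lower t xt∈ , upper
      where
      upper : x ≤ Mtop γ (mark t)
      upper with mark t <? k
      ... | yes t<k rewrite Mtop-inner γ (toℕ t) t<k = ≤-maximum _ (∈-withMark⁺ (top γ) xt∈ refl)
      ... | no  t≮k rewrite Mtop-last γ (toℕ t) t≮k = <⇒≤ (proj₂ (top-bounds xt∈))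
      lower : ∀ t → (x , t) ∈ top γ → Mtop γ (toℕ t) < x
      lower zero    xt∈ = proj₁ (top-bounds xt∈)
      lower (suc t) xt∈ with Mtop-previous γ top-max (suc t) z<s
      ... | u , Mu∈ , u≡t = <-reflects-position proj₁ (mark ∘ proj₂) top-decreasing
            (AllPairs.map⁻ (Equivalence.to (nonInc⇔AllPairs≥ _) top-marks)) Mu∈ xt∈ (subst (_< mark (suc t)) (sym u≡t) ≤-refl)
    bot-range : InRanges γ (bot γ)
    bot-range {x} {t} xt∈ with mark t <ᵇ k in eq | All.lookup (all⁺ (bottomOK γ) _ bottoms-ok) xt∈
    ... | true  | ok = <ᵇ⇒< _ x (proj₁ (Equivalence.to T-∧ ok)) , ≤ᵇ⇒≤ x _ (proj₂ (Equivalence.to T-∧ ok))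
    ... | false | ok = <ᵇ⇒< _ x (proj₁ (Equivalence.to T-∧ ok)) , <⇒≤ (<ᵇ⇒< x _ (proj₂ (Equivalence.to T-∧ ok)))

  Marked⇒extraOK : {γ : Symbol k} → Unimodal γ → Marked γ → T (extraOK γ)
  Marked⇒extraOK {γ} U Mk = Equivalence.from T-∧ (nonInc-of (top γ) top-decreasing top-range ,
    Equivalence.from T-∧ (nonInc-of (bot γ) bot-decreasing bot-range ,
    Equivalence.from T-∧ (all⁻ (hasMark γ) {xs = allFin k} (All.tabulate λ {t} _ → has-t t) , all⁻ (bottomOK γ) (All.tabulate bottom-ok))))
    where
    open Unimodal U
    open Marked Mk
    nonInc-of : (row : List (ℕ × Fin k)) → AllPairs (_>_ on proj₁) row → InRanges γ row → T (nonInc (marks row))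
    nonInc-of row sorted ranges = Equivalence.from (nonInc⇔AllPairs≥ _) (AllPairs.map⁺ (InRanges⇒marks-AllPairs≥ U top-max top-range sorted ranges))
    has-t : ∀ t → T (hasMark γ t)
    has-t t with mark t <ᵇ k in eq
    ... | true  = any⁺ _ (Any.map (λ { refl → ≡⇒≡ᵇ (mark t) (mark t) refl }) (top-max t (<ᵇ⇒< _ k (subst T (sym eq) tt))))
    ... | false = tt
    bottom-ok : ∀ {xt} → xt ∈ bot γ → T (bottomOK γ xt)
    bottom-ok {x , t} xt∈ with mark t <ᵇ k in eq
    ... | true  = Equivalence.from T-∧ (<⇒<ᵇ (proj₁ (bot-range xt∈)) ,
                    ≤⇒≤ᵇ (subst (x ≤_) (Mtop-inner γ (toℕ t) (<ᵇ⇒< _ k (subst T (sym eq) tt))) (proj₂ (bot-range xt∈))))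
    ... | false = Equivalence.from T-∧ (<⇒<ᵇ (proj₁ (bot-range xt∈)) , <⇒<ᵇ (proj₂ (bot-bounds xt∈)))

  Unimodal⇒Marked-k≡1 : k ≡ 1 → {γ : Symbol k} → Unimodal γ → Marked γ
  Unimodal⇒Marked-k≡1 refl U = record
    { top-range = λ { {t = zero} xt∈ → proj₁ (top-bounds xt∈) , <⇒≤ (proj₂ (top-bounds xt∈)) }
    ; top-max   = λ { zero (s≤s ()) }
    ; bot-range = λ { {t = zero} xt∈ → proj₁ (bot-bounds xt∈) , <⇒≤ (proj₂ (bot-bounds xt∈)) }
    }
    where open Unimodal U

  valid⇔ : 1 ≤ k → (γ : Symbol k) → T (valid γ) ⇔ (Unimodal γ × Marked γ)
  valid⇔ k≥1 γ = mk⇔ to from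
    where
    marked : Unimodal γ → (c : Bool) → (2 ≤ᵇ k) ≡ c → T (if c then extraOK γ else true) → Marked γ
    marked U true  _  extra = extraOK⇒Marked U extra
    marked U false k≱2 _    = Unimodal⇒Marked-k≡1 (≤-antisym (≮⇒≥ (λ k≥2 → subst T k≱2 (≤⇒≤ᵇ k≥2))) k≥1) U
    to : T (valid γ) → Unimodal γ × Marked γ
    to v = U , marked U (2 ≤ᵇ k) refl (proj₂ (Equivalence.to (T-∧ {basicOK γ}) v))
      where U = Equivalence.to (basicOK⇔Unimodal γ) (proj₁ (Equivalence.to (T-∧ {basicOK γ}) v))
    extra : Unimodal γ → Marked γ → (c : Bool) → T (if c then extraOK γ else true)
    extra U Mk true  = Marked⇒extraOK U Mk
    extra U Mk false = tt
    from : Unimodal γ × Marked γ → T (valid γ)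
    from (U , Mk) = Equivalence.from T-∧ (Equivalence.from (basicOK⇔Unimodal γ) U , extra U Mk (2 ≤ᵇ k))

-- Rows assembled from blocks

selected : (ℕ → ℕ) → {L : ℕ} → Vec Bool L → List ℕ
selected f []      = []
selected f (b ∷ v) = selected (f ∘ suc) v ++ (if b then f 0 ∷ [] else [])

∈-selected⁻ : (f : ℕ → ℕ) {L : ℕ} (v : Vec Bool L) {x : ℕ} → x ∈ selected f v →
  ∃ λ i → lookup v i ≡ true × x ≡ f (toℕ i)
∈-selected⁻ f (b ∷ v) x∈ with ∈-++⁻ (selected (f ∘ suc) v) x∈
... | inj₁ x∈v = let (i , vi , x≡) = ∈-selected⁻ (f ∘ suc) v x∈v in suc i , vi , x≡
∈-selected⁻ f (true ∷ v) x∈ | inj₂ (here x≡) = zero , refl , x≡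

∈-selected⁺ : (f : ℕ → ℕ) {L : ℕ} (v : Vec Bool L) (i : Fin L) → lookup v i ≡ true → f (toℕ i) ∈ selected f v
∈-selected⁺ f (true ∷ v) zero    refl = ∈-++⁺ʳ (selected (f ∘ suc) v) (here refl)
∈-selected⁺ f (b ∷ v)    (suc i) vi   = ∈-++⁺ˡ (∈-selected⁺ (f ∘ suc) v i vi)

selected-decreasing : (f : ℕ → ℕ) → (∀ {i j} → i < j → f i < f j) → {L : ℕ} (v : Vec Bool L) →
  AllPairs _>_ (selected f v)
selected-decreasing f f-mono []      = []
selected-decreasing f f-mono (b ∷ v) =
  AllPairs.++⁺ (selected-decreasing (f ∘ suc) (f-mono ∘ s≤s) v) (last b)
    (All.tabulate λ x∈ → All.tabulate (above-f0 b x∈))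
  where
  last : ∀ b → AllPairs _>_ (if b then f 0 ∷ [] else [])
  last true  = [] ∷ []
  last false = []
  above-f0 : ∀ b {x y} → x ∈ selected (f ∘ suc) v → y ∈ (if b then f 0 ∷ [] else []) → x > y
  above-f0 true x∈ (here refl) with ∈-selected⁻ (f ∘ suc) v x∈
  ... | i , _ , refl = f-mono z<s

[_] : Bool → ℕ
[ b ] = if b then 1 else 0

block : Bool → ℕ → (ℕ → ℕ) → {L : ℕ} → Vec Bool L → List ℕ
block c h f v = (if c then h ∷ [] else []) ++ selected f v

∈-block⁻ : (c : Bool) (h : ℕ) (f : ℕ → ℕ) {L : ℕ} (v : Vec Bool L) {x : ℕ} → x ∈ block c h f v →
  (T c × x ≡ h) ⊎ (∃ λ i → lookup v i ≡ true × x ≡ f (toℕ i))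
∈-block⁻ true  h f v (here x≡h)  = inj₁ (tt , x≡h)
∈-block⁻ true  h f v (there x∈) = inj₂ (∈-selected⁻ f v x∈)
∈-block⁻ false h f v x∈         = inj₂ (∈-selected⁻ f v x∈)

∈-block⁺ : (c : Bool) (h : ℕ) (f : ℕ → ℕ) {L : ℕ} (v : Vec Bool L) (i : Fin L) → lookup v i ≡ true →
  f (toℕ i) ∈ block c h f v
∈-block⁺ c h f v i vi = ∈-++⁺ʳ (if c then h ∷ [] else []) (∈-selected⁺ f v i vi)

block-decreasing : (c : Bool) (h : ℕ) (f : ℕ → ℕ) → (∀ {i j} → i < j → f i < f j) → {L : ℕ} (v : Vec Bool L) →
  (∀ (i : Fin L) → f (toℕ i) < h) → AllPairs _>_ (block c h f v)
block-decreasing false h f f-mono v _    = selected-decreasing f f-mono v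
block-decreasing true  h f f-mono v f<h  = All.tabulate below-h ∷ selected-decreasing f f-mono v
  where
  below-h : ∀ {x} → x ∈ selected f v → h > x
  below-h x∈ with ∈-selected⁻ f v x∈
  ... | i , _ , refl = f<h i

sum-block : (c : Bool) (h : ℕ) (f : ℕ → ℕ) {L : ℕ} (v : Vec Bool L) →
  sum (block c h f v) ≡ (if c then h else 0) + sum (selected f v)
sum-block true  h f v = refl
sum-block false h f v = refl

length-block : (c : Bool) (h : ℕ) (f : ℕ → ℕ) {L : ℕ} (v : Vec Bool L) →
  length (block c h f v) ≡ [ c ] + length (selected f v)
length-block true  h f v = refl
length-block false h f v = refl

module _ {k : ℕ} where

  -- Over allFin k the blocks of larger marks come first, so separated blocks give a decreasing row.
  rowOver : (Fin k → List ℕ) → List (Fin k) → List (ℕ × Fin k)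
  rowOver B = foldr (λ t row → row ++ map (_, t) (B t)) []

  rowOf : (Fin k → List ℕ) → List (ℕ × Fin k)
  rowOf B = rowOver B (allFin k)

  ∈-rowOver⁻ : (B : Fin k → List ℕ) (ts : List (Fin k)) {x : ℕ} {t : Fin k} → (x , t) ∈ rowOver B ts → t ∈ ts × x ∈ B t
  ∈-rowOver⁻ B (u ∷ ts) xt∈ with ∈-++⁻ (rowOver B ts) xt∈
  ... | inj₁ xt∈ts = map₁ there (∈-rowOver⁻ B ts xt∈ts)
  ... | inj₂ xt∈u with ∈-map⁻ (_, u) xt∈u
  ...   | x , x∈ , refl = here refl , x∈

  ∈-rowOver⁺ : (B : Fin k → List ℕ) (ts : List (Fin k)) {x : ℕ} {t : Fin k} → t ∈ ts → x ∈ B t → (x , t) ∈ rowOver B ts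
  ∈-rowOver⁺ B (u ∷ ts) (here refl) x∈ = ∈-++⁺ʳ (rowOver B ts) (∈-map⁺ (_, u) x∈)
  ∈-rowOver⁺ B (u ∷ ts) (there t∈)  x∈ = ∈-++⁺ˡ (∈-rowOver⁺ B ts t∈ x∈)

  rowOver-decreasing : (B : Fin k → List ℕ) → (∀ t → AllPairs _>_ (B t)) →
    (∀ {t u x y} → t Fin.< u → x ∈ B t → y ∈ B u → x < y) →
    {ts : List (Fin k)} → AllPairs Fin._<_ ts → AllPairs (_>_ on proj₁) (rowOver B ts)
  rowOver-decreasing B B-dec separated {[]} [] = []
  rowOver-decreasing B B-dec separated {u ∷ ts} (u< ∷ ts-sorted) =
    AllPairs.++⁺ (rowOver-decreasing B B-dec separated ts-sorted) (AllPairs.map⁺ (B-dec u))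
      (All.tabulate λ xt∈ → All.tabulate λ yu∈ → later-is-larger xt∈ yu∈)
    where
    later-is-larger : ∀ {xt yu} → xt ∈ rowOver B ts → yu ∈ map (_, u) (B u) → proj₁ xt > proj₁ yu
    later-is-larger {x , t} xt∈ yu∈ with ∈-rowOver⁻ B ts xt∈ | ∈-map⁻ (_, u) yu∈
    ... | t∈ , x∈ | y , y∈ , refl = separated (All.lookup u< t∈) y∈ x∈

  sum-rowOver : (B : Fin k → List ℕ) (ts : List (Fin k)) → sum (parts (rowOver B ts)) ≡ sum (map (sum ∘ B) ts)
  sum-rowOver B []       = refl
  sum-rowOver B (t ∷ ts) = begin
    sum (parts (rowOver B ts ++ map (_, t) (B t)))            ≡⟨ cong sum (map-++ proj₁ (rowOver B ts) _) ⟩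
    sum (parts (rowOver B ts) ++ parts (map (_, t) (B t)))     ≡⟨ sum-++ (parts (rowOver B ts)) _ ⟩
    sum (parts (rowOver B ts)) + sum (parts (map (_, t) (B t))) ≡⟨ cong₂ _+_ (sum-rowOver B ts) (cong sum (map-proj₁-tag (B t))) ⟩
    sum (map (sum ∘ B) ts) + sum (B t)                          ≡⟨ +-comm _ (sum (B t)) ⟩
    sum (B t) + sum (map (sum ∘ B) ts)                          ∎
    where
    open ≡-Reasoning
    map-proj₁-tag : ∀ xs → parts (map (_, t) xs) ≡ xs
    map-proj₁-tag xs = trans (sym (map-∘ xs)) (map-id xs)

  withMark-rowOf : (B : Fin k → List ℕ) → (∀ t → AllPairs _>_ (B t)) → AllPairs (_>_ on proj₁) (rowOf B) →
    (s : Fin k) → withMark (mark s) (rowOf B) ≡ B s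
  withMark-rowOf B B-dec row-dec s =
    AllPairs-unique (λ x≡y → <-irrefl (sym x≡y)) <-asym (AllPairs.map⁺ (AllPairs.filter⁺ _ row-dec)) (B-dec s) to from
    where
    to : ∀ {x} → x ∈ withMark (mark s) (rowOf B) → x ∈ B s
    to x∈ with ∈-withMark⁻ (rowOf B) x∈
    ... | t , xt∈ , t≡s = subst (λ u → _ ∈ B u) (mark-injective t≡s) (proj₂ (∈-rowOver⁻ B (allFin k) xt∈))
    from : ∀ {x} → x ∈ B s → x ∈ withMark (mark s) (rowOf B)
    from x∈ = ∈-withMark⁺ (rowOf B) (∈-rowOver⁺ B (allFin k) (∈-allFin s) x∈) refl

  ∈-rowOf⇔ : (B : Fin k → List ℕ) {x : ℕ} {t : Fin k} → (x , t) ∈ rowOf B ⇔ x ∈ B t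
  ∈-rowOf⇔ B = mk⇔ (proj₂ ∘ ∈-rowOver⁻ B (allFin k)) (∈-rowOver⁺ B (allFin k) (∈-allFin _))

M-mark : {n : ℕ} (m : Vec ℕ n) (t : Fin n) → M m (mark t) ≡ M m (toℕ t) + lookup m t
M-mark (a ∷ m) zero    = +-comm a 0
M-mark (a ∷ m) (suc t) = trans (cong (λ s → a + s) (M-mark m t)) (sym (+-assoc a _ _))

M-mono : {n : ℕ} (m : Vec ℕ n) {i j : ℕ} → i ≤ j → M m i ≤ M m j
M-mono m {zero} _ = z≤n
M-mono [] {suc i} {suc j} _ = z≤n
M-mono (a ∷ m) {suc i} {suc j} i≤j = +-monoʳ-≤ a (M-mono m (s≤s⁻¹ i≤j))

bit-allowed : ∀ {b c} → b Bool.≤ c → T b → T c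
bit-allowed b≤b t = t

module ℕΣ = CommutativeMonoidSum ℕ.+-0-commutativeMonoid
module ℤΣ = CommutativeMonoidSum ℤ.+-0-commutativeMonoid

sum-map-tabulate : {n : ℕ} (g : A → ℕ) (f : Fin n → A) → sum (map g (tabulate f)) ≡ ℕΣ.sum (g ∘ f)
sum-map-tabulate {n = zero}  g f = refl
sum-map-tabulate {n = suc n} g f = cong (λ x → g (f zero) + x) (sum-map-tabulate g (f ∘ suc))

ℕΣ-last : (n : ℕ) (g : Fin (suc n) → ℕ) → ℕΣ.sum (λ i → if mark i <ᵇ suc n then 0 else g i) ≡ g (Fin.fromℕ n)
ℕΣ-last zero    g = +-comm (g zero) 0
ℕΣ-last (suc n) g = ℕΣ-last n (g ∘ suc)

ℤΣ-δ : {n : ℕ} (s : Fin n) (g : Fin n → ℤ) → ℤΣ.sum (λ i → if toℕ s ≡ᵇ toℕ i then g i else + 0) ≡ g s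
ℤΣ-δ {suc n} zero    g = trans (cong (g zero +ℤ_) (ℤΣ.sum-replicate-zero n)) (ℤ.+-identityʳ _)
ℤΣ-δ {suc n} (suc s) g = trans (ℤ.+-identityˡ _) (ℤΣ-δ s (g ∘ suc))

ℕΣ-M-last : {n : ℕ} (m : Vec ℕ n) → ℕΣ.sum (λ (t : Fin n) → if mark t <ᵇ n then 0 else M m (mark t)) ≡ M m n
ℕΣ-M-last {zero}  m = refl
ℕΣ-M-last {suc n} m = trans (ℕΣ-last n (λ t → M m (mark t))) (cong (M m ∘ suc) (toℕ-fromℕ n))

module _ {k : ℕ} where

  lookup-bit : (e : Vec ℤ k) (d : ℕ) (b : Bool) (s : Fin k) → lookup (proj₁ (bit e d b)) s ≡ (if b then lookup e s else + 0)
  lookup-bit e d true  s = refl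
  lookup-bit e d false s = lookup-replicate s (+ 0)

  ∏-degree : {n : ℕ} {f : Fin n → A} {C : A → Set} (w : ∀ x → C x → Mono k) (cs : All C (tabulate f)) →
    proj₂ (∏ w cs) ≡ ℕΣ.sum (λ i → proj₂ (w (f i) (All.tabulate⁻ cs i)))
  ∏-degree {n = zero}  w []       = refl
  ∏-degree {n = suc n} w (c ∷ cs) = cong (λ x → proj₂ (w _ c) + x) (∏-degree w cs)

  ∏-exponent : {n : ℕ} {f : Fin n → A} {C : A → Set} (w : ∀ x → C x → Mono k) (cs : All C (tabulate f)) (s : Fin k) →
    lookup (proj₁ (∏ w cs)) s ≡ ℤΣ.sum (λ i → lookup (proj₁ (w (f i) (All.tabulate⁻ cs i))) s)
  ∏-exponent {n = zero}  w []       s = lookup-replicate s (+ 0)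
  ∏-exponent {n = suc n} w (c ∷ cs) s =
    trans (lookup-zipWith _+ℤ_ s (proj₁ (w _ c)) _) (cong (lookup (proj₁ (w _ c)) s +ℤ_) (∏-exponent w cs s))

  pochWeight-degree : (e : Vec ℤ k) (f : ℕ → ℕ) {L : ℕ} (v : Vec Bool L) →
    proj₂ (pochWeight e f v) ≡ sum (selected f v)
  pochWeight-degree e f []      = refl
  pochWeight-degree e f (b ∷ v) = begin
    proj₂ (bit e (f 0) b) + proj₂ (pochWeight e (f ∘ suc) v)           ≡⟨ cong₂ _+_ (degree-bit b) (pochWeight-degree e (f ∘ suc) v) ⟩
    sum (if b then f 0 ∷ [] else []) + sum (selected (f ∘ suc) v)     ≡⟨ +-comm (sum (if b then f 0 ∷ [] else [])) _ ⟩
    sum (selected (f ∘ suc) v) + sum (if b then f 0 ∷ [] else [])     ≡⟨ sum-++ (selected (f ∘ suc) v) _ ⟨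
    sum (selected f (b ∷ v))                                          ∎
    where
    open ≡-Reasoning
    degree-bit : ∀ b → proj₂ (bit e (f 0) b) ≡ sum (if b then f 0 ∷ [] else [])
    degree-bit true  = sym (+-identityʳ (f 0))
    degree-bit false = refl

  pochWeight-exponent : (e : Vec ℤ k) (f : ℕ → ℕ) {L : ℕ} (v : Vec Bool L) (s : Fin k) →
    lookup (proj₁ (pochWeight e f v)) s ≡ + length (selected f v) ℤ.* lookup e s
  pochWeight-exponent e f []      s = lookup-replicate s (+ 0)
  pochWeight-exponent e f (b ∷ v) s = begin
    lookup (proj₁ (bit e (f 0) b ∙ pochWeight e (f ∘ suc) v)) s
      ≡⟨ lookup-zipWith _+ℤ_ s (proj₁ (bit e (f 0) b)) _ ⟩
    lookup (proj₁ (bit e (f 0) b)) s +ℤ lookup (proj₁ (pochWeight e (f ∘ suc) v)) s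
      ≡⟨ cong₂ _+ℤ_ (lookup-bit e (f 0) b s) (pochWeight-exponent e (f ∘ suc) v s) ⟩
    (if b then lookup e s else + 0) +ℤ + length (selected (f ∘ suc) v) ℤ.* lookup e s
      ≡⟨ count-bit b ⟩
    + (length (selected (f ∘ suc) v) + length (if b then f 0 ∷ [] else [])) ℤ.* lookup e s
      ≡⟨ cong (λ n → + n ℤ.* lookup e s) (length-++ (selected (f ∘ suc) v)) ⟨
    + length (selected f (b ∷ v)) ℤ.* lookup e s
      ∎
    where
    open ≡-Reasoning
    count-bit : ∀ b → (if b then lookup e s else + 0) +ℤ + length (selected (f ∘ suc) v) ℤ.* lookup e s
                      ≡ + (length (selected (f ∘ suc) v) + length (if b then f 0 ∷ [] else [])) ℤ.* lookup e s
    count-bit true  = trans (add-one-copy (lookup e s) (+ length (selected (f ∘ suc) v)))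
                            (cong (ℤ._* lookup e s) (sym (ℤ.pos-+ (length (selected (f ∘ suc) v)) 1)))
      where
      add-one-copy : ∀ x n → x +ℤ n ℤ.* x ≡ (n +ℤ + 1) ℤ.* x
      add-one-copy = ℤ-Solver.solve-∀
    count-bit false rewrite +-identityʳ (length (selected (f ∘ suc) v)) = ℤ.+-identityˡ _

module _ {k : ℕ} where

  δ : Fin k → Fin k → ℤ → ℤ
  δ s t z = if toℕ s ≡ᵇ toℕ t then z else + 0

  lookup-xe : (t s : Fin k) (z : ℤ) → lookup (xe t z) s ≡ δ s t z
  lookup-xe t s z = lookup∘tabulate _ s

  lookup-bit-xe : (t s : Fin k) (z : ℤ) (d : ℕ) (b : Bool) → lookup (proj₁ (bit (xe t z) d b)) s ≡ δ s t (if b then z else + 0)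
  lookup-bit-xe t s z d true  = lookup-xe t s z
  lookup-bit-xe t s z d false with toℕ s ≡ᵇ toℕ t
  ... | true  = lookup-replicate s (+ 0)
  ... | false = lookup-replicate s (+ 0)

  δ-linear : (s t : Fin k) (a b : ℤ) (y z : ℤ) → a ℤ.* δ s t y +ℤ b ℤ.* δ s t z ≡ δ s t (a ℤ.* y +ℤ b ℤ.* z)
  δ-linear s t a b y z with toℕ s ≡ᵇ toℕ t
  ... | true  = refl
  ... | false = cong₂ _+ℤ_ (ℤ.*-zeroʳ a) (ℤ.*-zeroʳ b)

-- Reading a choice off a symbol

restrict : (c : Bool) → Bool → OptionalBit c
restrict true  false = false , f≤t
restrict true  true  = true , b≤b
restrict false _     = false , b≤b

T-restrict⇔ : (c b : Bool) → T (proj₁ (restrict c b)) ⇔ (T c × T b)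
T-restrict⇔ true  true  = mk⇔ (λ _ → tt , tt) (λ _ → tt)
T-restrict⇔ true  false = mk⇔ (λ ()) proj₂
T-restrict⇔ false b     = mk⇔ (λ ()) proj₁

restrict-≡ : (c b : Bool) (ob : OptionalBit c) → (T c → b ≡ proj₁ ob) → restrict c b ≡ ob
restrict-≡ true  false (false , f≤t) _ = refl
restrict-≡ true  true  (true , b≤b)  _ = refl
restrict-≡ true  false (true , b≤b)  b≡ = case b≡ tt of λ ()
restrict-≡ true  true  (false , f≤t) b≡ = case b≡ tt of λ ()
restrict-≡ false b     (false , b≤b) _ = refl

module _ {k : ℕ} where

  _≟ᵖ_ : DecidableEquality (ℕ × Fin k)
  _≟ᵖ_ = Product.≡-dec ℕ._≟_ Fin._≟_

  member : ℕ × Fin k → List (ℕ × Fin k) → Bool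
  member z row = does (DecMembership._∈?_ _≟ᵖ_ z row)

  member-≡ : ∀ {z row b} → (z ∈ row → T b) → (T b → z ∈ row) → member z row ≡ b
  member-≡ {z} {row} = does-≡ (DecMembership._∈?_ _≟ᵖ_ z row)

  T-member⇔ : ∀ {z row} → T (member z row) ⇔ z ∈ row
  T-member⇔ {z} {row} with DecMembership._∈?_ _≟ᵖ_ z row
  ... | yes z∈ = mk⇔ (λ _ → z∈) (λ _ → tt)
  ... | no  z∉ = mk⇔ (λ ()) z∉

  gapsOf : Symbol k → Vec ℕ k
  gapsOf γ = Vec.tabulate (λ t → Mtop γ (mark t) ∸ Mtop γ (toℕ t))

  readBits : Symbol k → List (ℕ × Fin k) → (t : Fin k) (L : ℕ) → Vec Bool L
  readBits γ row t L = Vec.tabulate (λ i → member (Mtop γ (toℕ t) + 1 + toℕ i , t) row)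

  decodeBit : Symbol k → (t : Fin k) → OptionalBit (mark t <ᵇ k)
  decodeBit γ t = restrict (mark t <ᵇ k) (member (Mtop γ (mark t) , t) (bot γ))

  decodeBlockBits : Symbol k → (m : Vec ℕ k) (t : Fin k) → BlockBits m t
  decodeBlockBits γ m t = readBits γ (top γ) t _ , readBits γ (bot γ) t _

  -- m is a parameter rather than gapsOf γ, so that the round trips need no transport along m ≡ gapsOf γ.
  decode : Symbol k → (m : Vec ℕ k) → Choice m
  decode γ m = All.tabulate⁺ (decodeBit γ) , All.tabulate⁺ (decodeBlockBits γ m)

-- Encoding a choice as a symbol

module _ {k : ℕ} where

  Positive : Vec ℕ k → Set
  Positive m = ∀ t → 1 ≤ lookup m t

  module Blocks (m : Vec ℕ k) where

    lo hi : Fin k → ℕ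
    lo t = M m (toℕ t)
    hi t = M m (mark t)

    offset : Fin k → ℕ → ℕ
    offset t i = lo t + 1 + i

    hi≡lo+ : ∀ t → hi t ≡ lo t + lookup m t
    hi≡lo+ = M-mark m

    hi≤lo : ∀ {t u} → toℕ t < toℕ u → hi t ≤ lo u
    hi≤lo = M-mono m

    hi≤peak : ∀ t → hi t ≤ M m k
    hi≤peak t = M-mono m (toℕ<n t)

    module Positivity (pos : Positive m) where

      lo<hi : ∀ t → lo t < hi t
      lo<hi t = subst (lo t <_) (sym (hi≡lo+ t)) (m<m+n (lo t) (pos t))

      offset-end : ∀ t → lo t + 1 + (lookup m t ∸ 1) ≡ hi t
      offset-end t = begin
        lo t + 1 + (lookup m t ∸ 1)   ≡⟨ +-assoc (lo t) 1 _ ⟩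
        lo t + (1 + (lookup m t ∸ 1)) ≡⟨ cong (λ n → lo t + n) (m+[n∸m]≡n (pos t)) ⟩
        lo t + lookup m t             ≡⟨ hi≡lo+ t ⟨
        hi t                          ∎
        where open ≡-Reasoning

      offset<hi : ∀ t (i : Fin (lookup m t ∸ 1)) → offset t (toℕ i) < hi t
      offset<hi t i = subst (offset t (toℕ i) <_) (offset-end t) (+-monoʳ-< (lo t + 1) (toℕ<n i))

      lo<offset : ∀ t i → lo t < offset t i
      lo<offset t i = <-≤-trans (m<m+n (lo t) z<s) (m≤m+n (lo t + 1) i)

      hi<peak : ∀ t → mark t < k → hi t < M m k
      hi<peak t t<k = subst (_< M m k) (cong (M m) (toℕ-fromℕ< t<k)) (<-≤-trans (lo<hi u) (hi≤peak u))
        where u = fromℕ< t<k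

      ∈-block-at : ∀ {b t x} (v : Vec Bool (lookup m t ∸ 1)) → x ∈ block b (hi t) (offset t) v →
        lo t < x × ((T b × x ≡ hi t) ⊎ x < hi t)
      ∈-block-at {b} {t} v x∈ with ∈-block⁻ b (hi t) (offset t) v x∈
      ... | inj₁ (bt , refl)      = lo<hi t , inj₁ (bt , refl)
      ... | inj₂ (i , _ , refl)   = lo<offset t (toℕ i) , inj₂ (offset<hi t i)

      block-range : ∀ {b t x} (v : Vec Bool (lookup m t ∸ 1)) → x ∈ block b (hi t) (offset t) v → lo t < x × x ≤ hi t
      block-range v x∈ with ∈-block-at v x∈
      ... | lo<x , inj₁ (_ , refl) = lo<x , ≤-refl
      ... | lo<x , inj₂ x<hi      = lo<x , <⇒≤ x<hi

      block-below-peak : ∀ {b t x} → (T b → mark t < k) → (v : Vec Bool (lookup m t ∸ 1)) →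
        x ∈ block b (hi t) (offset t) v → 1 ≤ x × x < M m k
      block-below-peak {t = t} b⇒t<k v x∈ with ∈-block-at v x∈
      ... | lo<x , inj₁ (bt , refl) = <-≤-trans z<s lo<x , hi<peak t (b⇒t<k bt)
      ... | lo<x , inj₂ x<hi       = <-≤-trans z<s lo<x , <-≤-trans x<hi (hi≤peak t)

      blockAt-decreasing : ∀ b t (v : Vec Bool (lookup m t ∸ 1)) → AllPairs _>_ (block b (hi t) (offset t) v)
      blockAt-decreasing b t v = block-decreasing b (hi t) (offset t) (+-monoʳ-< (lo t + 1)) v (offset<hi t)

      rowOfBlocks-decreasing : (bits : Fin k → Bool) (vs : (t : Fin k) → Vec Bool (lookup m t ∸ 1)) →
        AllPairs (_>_ on proj₁) (rowOf (λ t → block (bits t) (hi t) (offset t) (vs t)))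
      rowOfBlocks-decreasing bits vs =
        rowOver-decreasing _ (λ t → blockAt-decreasing (bits t) t (vs t)) separated (AllPairs.tabulate⁺-< id)
        where
        separated : ∀ {t u x y} → t Fin.< u → x ∈ block (bits t) (hi t) (offset t) (vs t) →
          y ∈ block (bits u) (hi u) (offset u) (vs u) → x < y
        separated t<u x∈ y∈ = ≤-<-trans (proj₂ (block-range (vs _) x∈)) (≤-<-trans (hi≤lo t<u) (proj₁ (block-range (vs _) y∈)))

      hi∈block⇔ : ∀ {b t} (v : Vec Bool (lookup m t ∸ 1)) → hi t ∈ block b (hi t) (offset t) v ⇔ T b
      hi∈block⇔ {b} {t} v = mk⇔ to (from b)
        where
        to : hi t ∈ block b (hi t) (offset t) v → T b
        to hi∈ with ∈-block-at v hi∈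
        ... | _ , inj₁ (tb , _) = tb
        ... | _ , inj₂ hi<hi    = ⊥-elim (<-irrefl refl hi<hi)
        from : ∀ b → T b → hi t ∈ block b (hi t) (offset t) v
        from true _ = here refl

      offset∈block⇔ : ∀ {b t} (v : Vec Bool (lookup m t ∸ 1)) (i : Fin (lookup m t ∸ 1)) →
        offset t (toℕ i) ∈ block b (hi t) (offset t) v ⇔ T (lookup v i)
      offset∈block⇔ {b} {t} v i = mk⇔ to (λ vi → ∈-block⁺ b (hi t) (offset t) v i (Equivalence.to T-≡ vi))
        where
        to : offset t (toℕ i) ∈ block b (hi t) (offset t) v → T (lookup v i)
        to x∈ with ∈-block⁻ b (hi t) (offset t) v x∈
        ... | inj₁ (_ , x≡hi) = ⊥-elim (<-irrefl x≡hi (offset<hi t i))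
        ... | inj₂ (j , vj , x≡) with toℕ-injective (+-cancelˡ-≡ (lo t + 1) (toℕ i) (toℕ j) x≡)
        ...   | refl = Equivalence.from T-≡ vj

      rowOf-blocks-≡ : (row : List (ℕ × Fin k)) → AllPairs (_>_ on proj₁) row →
        (∀ {x t} → (x , t) ∈ row → lo t < x × x ≤ hi t) →
        (bits : Fin k → Bool) → (∀ t → (hi t , t) ∈ row ⇔ T (bits t)) →
        (vs : (t : Fin k) → Vec Bool (lookup m t ∸ 1)) → (∀ t i → (offset t (toℕ i) , t) ∈ row ⇔ T (lookup (vs t) i)) →
        rowOf (λ t → block (bits t) (hi t) (offset t) (vs t)) ≡ row
      rowOf-blocks-≡ row row-decreasing ranges bits hi∈⇔ vs offset∈⇔ =
        AllPairs-unique (λ y≡z → <-irrefl (cong proj₁ (sym y≡z))) <-asym (rowOfBlocks-decreasing bits vs) row-decreasing to from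
        where
        blocks : Fin k → List ℕ
        blocks t = block (bits t) (hi t) (offset t) (vs t)
        to : ∀ {z} → z ∈ rowOf blocks → z ∈ row
        to {x , t} z∈ with ∈-block⁻ (bits t) (hi t) (offset t) (vs t) (Equivalence.to (∈-rowOf⇔ blocks) z∈)
        ... | inj₁ (bt , refl)     = Equivalence.from (hi∈⇔ t) bt
        ... | inj₂ (i , vi , refl) = Equivalence.from (offset∈⇔ t i) (Equivalence.from T-≡ vi)
        from : ∀ {z} → z ∈ row → z ∈ rowOf blocks
        from {x , t} z∈ with ranges z∈ | x ≟ hi t
        ... | _ | yes refl = Equivalence.from (∈-rowOf⇔ blocks) (Equivalence.from (hi∈block⇔ (vs t)) (Equivalence.to (hi∈⇔ t) z∈))
        ... | lo<x , x≤hi | no x≢hi =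
          Equivalence.from (∈-rowOf⇔ blocks) (subst (_∈ blocks t) offset≡x
            (∈-block⁺ (bits t) (hi t) (offset t) (vs t) i (Equivalence.to T-≡ (Equivalence.to (offset∈⇔ t i)
              (subst (λ y → (y , t) ∈ row) (sym offset≡x) z∈)))))
          where
          lo+1≤x : lo t + 1 ≤ x
          lo+1≤x = subst (_≤ x) (+-comm 1 (lo t)) lo<x
          i<gap : x ∸ (lo t + 1) < lookup m t ∸ 1
          i<gap = subst (x ∸ (lo t + 1) <_) (m+n∸m≡n (lo t + 1) (lookup m t ∸ 1))
                    (∸-monoˡ-< (subst (x <_) (sym (offset-end t)) (≤∧≢⇒< x≤hi x≢hi)) lo+1≤x)
          i : Fin (lookup m t ∸ 1)
          i = fromℕ< i<gap
          offset≡x : offset t (toℕ i) ≡ x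
          offset≡x = trans (cong (λ j → lo t + 1 + j) (toℕ-fromℕ< i<gap)) (m+[n∸m]≡n lo+1≤x)

  module Encoding (m : Vec ℕ k) (c : Choice m) where

    open Blocks m

    bitAt : Fin k → Bool
    bitAt t = proj₁ (All.tabulate⁻ (proj₁ c) t)

    topBits botBits : (t : Fin k) → Vec Bool (lookup m t ∸ 1)
    topBits t = proj₁ (All.tabulate⁻ (proj₂ c) t)
    botBits t = proj₂ (All.tabulate⁻ (proj₂ c) t)

    topBlock botBlock : Fin k → List ℕ
    topBlock t = block (mark t <ᵇ k) (hi t) (offset t) (topBits t)
    botBlock t = block (bitAt t) (hi t) (offset t) (botBits t)

    symbolOf : Symbol k
    symbolOf = symbol (M m k) (rowOf topBlock) (rowOf botBlock)

    topHi botHi topSel botSel : Fin k → ℕ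
    topHi t  = if mark t <ᵇ k then hi t else 0
    botHi t  = if bitAt t then hi t else 0
    topSel t = sum (selected (offset t) (topBits t))
    botSel t = sum (selected (offset t) (botBits t))

    topCount botCount : Fin k → ℕ
    topCount t = length (selected (offset t) (topBits t))
    botCount t = length (selected (offset t) (botBits t))

    size-encode : size symbolOf ≡ M m k + ℕΣ.sum (λ t → topHi t + topSel t) + ℕΣ.sum (λ t → botHi t + botSel t)
    size-encode = cong₂ (λ a b → M m k + a + b)
      (row-sum topBlock {g = λ t → topHi t + topSel t} (λ t → sum-block (mark t <ᵇ k) (hi t) (offset t) (topBits t)))
      (row-sum botBlock {g = λ t → botHi t + botSel t} (λ t → sum-block (bitAt t) (hi t) (offset t) (botBits t)))
      where
      row-sum : (B : Fin k → List ℕ) {g : Fin k → ℕ} → (∀ t → sum (B t) ≡ g t) → sum (parts (rowOf B)) ≡ ℕΣ.sum g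
      row-sum B B≡g = trans (sum-rowOver B (allFin k)) (trans (sum-map-tabulate (sum ∘ B) id) (ℕΣ.sum-cong-≗ {k} B≡g))

    degree-termWeight : proj₂ (termWeight m c) ≡ ℕΣ.sum hi + (ℕΣ.sum botHi + ℕΣ.sum (λ t → topSel t + botSel t))
    degree-termWeight = begin
      proj₂ (termWeight m c)
        ≡⟨ cong₂ _+_ (sum-map-tabulate (λ (t : Fin k) → M m (mark t)) id)
                     (cong₂ _+_ (∏-degree (bitWeight m) (proj₁ c)) (∏-degree (blockWeight m) (proj₂ c))) ⟩
      ℕΣ.sum hi + (ℕΣ.sum (λ t → proj₂ (bitWeight m t (All.tabulate⁻ (proj₁ c) t)))
                   + ℕΣ.sum (λ t → proj₂ (blockWeight m t (All.tabulate⁻ (proj₂ c) t))))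
        ≡⟨ cong₂ (λ a b → ℕΣ.sum hi + (a + b)) (ℕΣ.sum-cong-≗ {k} (λ t → degree-bit (bitAt t)))
             (ℕΣ.sum-cong-≗ {k} λ t → cong₂ _+_ (pochWeight-degree (xe t (+ 1)) (offset t) (topBits t))
                                                (pochWeight-degree (xe t -[1+ 0 ]) (offset t) (botBits t))) ⟩
      ℕΣ.sum hi + (ℕΣ.sum botHi + ℕΣ.sum (λ t → topSel t + botSel t))
        ∎
      where
      open ≡-Reasoning
      degree-bit : ∀ {e d} b → proj₂ (bit {k} e d b) ≡ (if b then d else 0)
      degree-bit true  = refl
      degree-bit false = refl

    sum-hi : ℕΣ.sum hi ≡ ℕΣ.sum topHi + M m k
    sum-hi = begin
      ℕΣ.sum hi                                                               ≡⟨ ℕΣ.sum-cong-≗ {k} hi-split ⟩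
      ℕΣ.sum (λ t → topHi t + (if mark t <ᵇ k then 0 else hi t))             ≡⟨ ℕΣ.∑-distrib-+ topHi _ ⟩
      ℕΣ.sum topHi + ℕΣ.sum (λ t → if mark t <ᵇ k then 0 else hi t)          ≡⟨ cong (λ x → ℕΣ.sum topHi + x) (ℕΣ-M-last m) ⟩
      ℕΣ.sum topHi + M m k                                                    ∎
      where
      open ≡-Reasoning
      hi-split : ∀ t → hi t ≡ topHi t + (if mark t <ᵇ k then 0 else hi t)
      hi-split t with mark t <ᵇ k
      ... | true  = sym (+-identityʳ (hi t))
      ... | false = refl

    degree-encode : proj₂ (termWeight m c) ≡ size symbolOf
    degree-encode = begin
      proj₂ (termWeight m c)                                                     ≡⟨ degree-termWeight ⟩
      ℕΣ.sum hi + (ℕΣ.sum botHi + ℕΣ.sum (λ t → topSel t + botSel t))           ≡⟨ cong₂ (λ a b → a + (ℕΣ.sum botHi + b)) sum-hi (ℕΣ.∑-distrib-+ topSel botSel) ⟩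
      (ℕΣ.sum topHi + M m k) + (ℕΣ.sum botHi + (ℕΣ.sum topSel + ℕΣ.sum botSel))  ≡⟨ rearrange (ℕΣ.sum topHi) (M m k) (ℕΣ.sum botHi) (ℕΣ.sum topSel) (ℕΣ.sum botSel) ⟩
      M m k + (ℕΣ.sum topHi + ℕΣ.sum topSel) + (ℕΣ.sum botHi + ℕΣ.sum botSel)   ≡⟨ cong₂ (λ a b → M m k + a + b) (ℕΣ.∑-distrib-+ topHi topSel) (ℕΣ.∑-distrib-+ botHi botSel) ⟨
      M m k + ℕΣ.sum (λ t → topHi t + topSel t) + ℕΣ.sum (λ t → botHi t + botSel t) ≡⟨ size-encode ⟨
      size symbolOf                                                              ∎
      where
      open ≡-Reasoning
      rearrange : ∀ a p b v w → (a + p) + (b + (v + w)) ≡ p + (a + v) + (b + w)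
      rearrange = ℕ-Solver.solve-∀

    bits-exponent : ∀ s → lookup (proj₁ (∏ (bitWeight m) (proj₁ c))) s ≡ - (+ [ bitAt s ])
    bits-exponent s = begin
      lookup (proj₁ (∏ (bitWeight m) (proj₁ c))) s
        ≡⟨ ∏-exponent (bitWeight m) (proj₁ c) s ⟩
      ℤΣ.sum (λ t → lookup (proj₁ (bitWeight m t (All.tabulate⁻ (proj₁ c) t))) s)
        ≡⟨ ℤΣ.sum-cong-≗ {k} (λ t → lookup-bit-xe t s -[1+ 0 ] (hi t) (bitAt t)) ⟩
      ℤΣ.sum (λ t → δ s t (if bitAt t then -[1+ 0 ] else + 0))
        ≡⟨ ℤΣ-δ s (λ t → if bitAt t then -[1+ 0 ] else + 0) ⟩
      (if bitAt s then -[1+ 0 ] else + 0)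
        ≡⟨ negated-indicator (bitAt s) ⟩
      - (+ [ bitAt s ])
        ∎
      where
      open ≡-Reasoning
      negated-indicator : ∀ b → (if b then -[1+ 0 ] else + 0) ≡ - (+ [ b ])
      negated-indicator true  = refl
      negated-indicator false = refl

    blocks-exponent : ∀ s → lookup (proj₁ (∏ (blockWeight m) (proj₂ c))) s ≡ + topCount s ℤ.* + 1 +ℤ + botCount s ℤ.* -[1+ 0 ]
    blocks-exponent s = begin
      lookup (proj₁ (∏ (blockWeight m) (proj₂ c))) s
        ≡⟨ ∏-exponent (blockWeight m) (proj₂ c) s ⟩
      ℤΣ.sum (λ t → lookup (proj₁ (blockWeight m t (All.tabulate⁻ (proj₂ c) t))) s)
        ≡⟨ ℤΣ.sum-cong-≗ {k} block-exponent ⟩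
      ℤΣ.sum (λ t → δ s t (+ topCount t ℤ.* + 1 +ℤ + botCount t ℤ.* -[1+ 0 ]))
        ≡⟨ ℤΣ-δ s _ ⟩
      + topCount s ℤ.* + 1 +ℤ + botCount s ℤ.* -[1+ 0 ]
        ∎
      where
      open ≡-Reasoning
      block-exponent : ∀ t → lookup (proj₁ (blockWeight m t (All.tabulate⁻ (proj₂ c) t))) s
        ≡ δ s t (+ topCount t ℤ.* + 1 +ℤ + botCount t ℤ.* -[1+ 0 ])
      block-exponent t = trans (lookup-zipWith _+ℤ_ s (proj₁ (pochWeight (xe t (+ 1)) (offset t) (topBits t))) _)
        (trans (cong₂ _+ℤ_ (trans (pochWeight-exponent (xe t (+ 1)) (offset t) (topBits t) s) (cong (+ topCount t ℤ.*_) (lookup-xe t s (+ 1))))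
                           (trans (pochWeight-exponent (xe t -[1+ 0 ]) (offset t) (botBits t) s) (cong (+ botCount t ℤ.*_) (lookup-xe t s -[1+ 0 ]))))
               (δ-linear s t (+ topCount t) (+ botCount t) (+ 1) -[1+ 0 ]))

    bit≤ : ∀ t → bitAt t Bool.≤ (mark t <ᵇ k)
    bit≤ t = proj₂ (All.tabulate⁻ (proj₁ c) t)

    module _ (pos : Positive m) where

      open Blocks.Positivity m pos

      top-decreasing : AllPairs (_>_ on proj₁) (rowOf topBlock)
      top-decreasing = rowOfBlocks-decreasing (λ t → mark t <ᵇ k) topBits

      bot-decreasing : AllPairs (_>_ on proj₁) (rowOf botBlock)
      bot-decreasing = rowOfBlocks-decreasing bitAt botBits

      withMark-top : ∀ t → withMark (mark t) (rowOf topBlock) ≡ topBlock t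
      withMark-top = withMark-rowOf topBlock (λ t → blockAt-decreasing _ t (topBits t)) top-decreasing

      withMark-bot : ∀ t → withMark (mark t) (rowOf botBlock) ≡ botBlock t
      withMark-bot = withMark-rowOf botBlock (λ t → blockAt-decreasing _ t (botBits t)) bot-decreasing

      Mtop-mark : ∀ t → Mtop symbolOf (mark t) ≡ hi t
      Mtop-mark t with mark t <? k
      ... | yes t<k = begin
        Mtop symbolOf (mark t)                         ≡⟨ Mtop-inner symbolOf (toℕ t) t<k ⟩
        foldr _⊔_ 0 (withMark (mark t) (rowOf topBlock)) ≡⟨ cong (foldr _⊔_ 0) (withMark-top t) ⟩
        foldr _⊔_ 0 (topBlock t)                       ≡⟨ maximum-≡ (topBlock t) hi∈ (proj₂ ∘ block-range (topBits t)) ⟩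
        hi t                                           ∎
        where
        open ≡-Reasoning
        hi∈ : hi t ∈ topBlock t
        hi∈ rewrite <⇒<ᵇ≡true t<k = here refl
      ... | no t≮k = trans (Mtop-last symbolOf (toℕ t) t≮k) (cong (M m) (≤-antisym (≮⇒≥ t≮k) (toℕ<n t)))

      Mtop-toℕ : ∀ t → Mtop symbolOf (toℕ t) ≡ lo t
      Mtop-toℕ zero    = refl
      Mtop-toℕ (suc t) = subst (λ j → Mtop symbolOf j ≡ M m j) (cong suc (toℕ-inject₁ t)) (Mtop-mark (inject₁ t))

      encode-Marked : Marked symbolOf
      encode-Marked = record
        { top-range = λ {x} {t} xt∈ → in-range (block-range (topBits t) (proj₂ (∈-rowOver⁻ topBlock (allFin k) xt∈)))
        ; top-max   = λ t t<k → subst (λ h → (h , t) ∈ rowOf topBlock) (sym (Mtop-mark t))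
                        (∈-rowOver⁺ topBlock (allFin k) (∈-allFin t) (subst (λ b → hi t ∈ block b (hi t) (offset t) (topBits t))
                          (sym (<⇒<ᵇ≡true t<k)) (here refl)))
        ; bot-range = λ {x} {t} xt∈ → in-range (block-range (botBits t) (proj₂ (∈-rowOver⁻ botBlock (allFin k) xt∈)))
        }
        where
        in-range : ∀ {x t} → lo t < x × x ≤ hi t → Mtop symbolOf (toℕ t) < x × x ≤ Mtop symbolOf (mark t)
        in-range {t = t} = subst₂ (λ a b → a < _ × _ ≤ b) (sym (Mtop-toℕ t)) (sym (Mtop-mark t))

      encode-Unimodal : 1 ≤ k → Unimodal symbolOf
      encode-Unimodal k≥1 = record
        { peak-positive  = <-≤-trans z<s (<-≤-trans (lo<hi t₀) (hi≤peak t₀))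
        ; top-bounds     = λ {x} {t} xt∈ → block-below-peak (<ᵇ⇒< _ k) (topBits t) (proj₂ (∈-rowOver⁻ topBlock (allFin k) xt∈))
        ; bot-bounds     = λ {x} {t} xt∈ → block-below-peak (<ᵇ⇒< _ k ∘ bit-allowed (bit≤ t)) (botBits t) (proj₂ (∈-rowOver⁻ botBlock (allFin k) xt∈))
        ; top-decreasing = top-decreasing
        ; bot-decreasing = bot-decreasing
        }
        where t₀ = fromℕ< k≥1

      encode-valid : 1 ≤ k → T (valid symbolOf)
      encode-valid k≥1 = Equivalence.from (valid⇔ k≥1 symbolOf) (encode-Unimodal k≥1 , encode-Marked)

      ℓ-top : ∀ s → ℓ (mark s) (rowOf topBlock) ≡ [ mark s <ᵇ k ] + topCount s
      ℓ-top s = trans (cong length (withMark-top s)) (length-block (mark s <ᵇ k) (hi s) (offset s) (topBits s))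

      ℓ-bot : ∀ s → ℓ (mark s) (rowOf botBlock) ≡ [ bitAt s ] + botCount s
      ℓ-bot s = trans (cong length (withMark-bot s)) (length-block (bitAt s) (hi s) (offset s) (botBits s))

      exponent-encode : ∀ s → lookup (proj₁ (termWeight m c)) s ≡ lookup (rank symbolOf) s
      exponent-encode s = begin
        lookup (proj₁ (termWeight m c)) s
          ≡⟨ lookup-zipWith _+ℤ_ s (replicate k (+ 0)) _ ⟩
        lookup (replicate k (+ 0)) s +ℤ lookup (proj₁ (∏ (bitWeight m) (proj₁ c) ∙ ∏ (blockWeight m) (proj₂ c))) s
          ≡⟨ cong₂ _+ℤ_ (lookup-replicate s (+ 0)) (lookup-zipWith _+ℤ_ s (proj₁ (∏ (bitWeight m) (proj₁ c))) _) ⟩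
        + 0 +ℤ (lookup (proj₁ (∏ (bitWeight m) (proj₁ c))) s +ℤ lookup (proj₁ (∏ (blockWeight m) (proj₂ c))) s)
          ≡⟨ cong (+ 0 +ℤ_) (cong₂ _+ℤ_ (bits-exponent s) (blocks-exponent s)) ⟩
        + 0 +ℤ (- (+ [ bitAt s ]) +ℤ (+ topCount s ℤ.* + 1 +ℤ + botCount s ℤ.* -[1+ 0 ]))
          ≡⟨ rearrange (+ [ mark s <ᵇ k ]) (+ [ bitAt s ]) (+ topCount s) (+ botCount s) ⟩
        ((+ [ mark s <ᵇ k ] +ℤ + topCount s) ℤ.- (+ [ bitAt s ] +ℤ + botCount s)) ℤ.- + [ mark s <ᵇ k ]
          ≡⟨ cong₂ ℤ._-_ (cong₂ ℤ._-_ (trans (sym (ℤ.pos-+ [ mark s <ᵇ k ] (topCount s))) (cong +_ (sym (ℓ-top s))))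
                                      (trans (sym (ℤ.pos-+ [ bitAt s ] (botCount s))) (cong +_ (sym (ℓ-bot s)))))
                         (indicator-ℤ (mark s <ᵇ k)) ⟩
        ((+ ℓ (mark s) (rowOf topBlock)) ℤ.- (+ ℓ (mark s) (rowOf botBlock))) ℤ.- (if mark s <ᵇ k then + 1 else + 0)
          ≡⟨ lookup∘tabulate _ s ⟨
        lookup (rank symbolOf) s
          ∎
        where
        open ≡-Reasoning
        indicator-ℤ : ∀ b → + [ b ] ≡ (if b then + 1 else + 0)
        indicator-ℤ true  = refl
        indicator-ℤ false = refl
        rearrange : ∀ a b v w → + 0 +ℤ (- b +ℤ (v ℤ.* + 1 +ℤ w ℤ.* -[1+ 0 ])) ≡ ((a +ℤ v) ℤ.- (b +ℤ w)) ℤ.- a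
        rearrange = ℤ-Solver.solve-∀

      weight-encode : termWeight m c ≡ (rank symbolOf , size symbolOf)
      weight-encode = cong₂ _,_ (Vec-≡ exponent-encode) degree-encode

      module _ (bits : Fin k → Bool) (vs : (t : Fin k) → Vec Bool (lookup m t ∸ 1)) where

        blocks : Fin k → List ℕ
        blocks u = block (bits u) (hi u) (offset u) (vs u)

        read-block-top : ∀ t → member (Mtop symbolOf (mark t) , t) (rowOf blocks) ≡ bits t
        read-block-top t = trans (cong (λ h → member (h , t) (rowOf blocks)) (Mtop-mark t))
          (member-≡ (Equivalence.to (hi∈block⇔ (vs t)) ∘ Equivalence.to (∈-rowOf⇔ blocks))
                    (Equivalence.from (∈-rowOf⇔ blocks) ∘ Equivalence.from (hi∈block⇔ (vs t))))

        read-block-bits : ∀ t → readBits symbolOf (rowOf blocks) t (lookup m t ∸ 1) ≡ vs t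
        read-block-bits t = Vec-≡ λ i → trans (lookup∘tabulate _ i)
          (trans (cong (λ l → member (l + 1 + toℕ i , t) (rowOf blocks)) (Mtop-toℕ t))
                 (member-≡ (Equivalence.to (offset∈block⇔ (vs t) i) ∘ Equivalence.to (∈-rowOf⇔ blocks))
                           (Equivalence.from (∈-rowOf⇔ blocks) ∘ Equivalence.from (offset∈block⇔ (vs t) i))))

      decode-encode : decode symbolOf m ≡ c
      decode-encode = cong₂ _,_
        (All-tabulate⁻-injective _ (proj₁ c) λ t → trans (All-tabulate⁻∘⁺ _ t)
           (restrict-≡ _ _ _ (λ _ → read-block-top bitAt botBits t)))
        (All-tabulate⁻-injective _ (proj₂ c) λ t → trans (All-tabulate⁻∘⁺ _ t)
           (cong₂ _,_ (read-block-bits (λ u → mark u <ᵇ k) topBits t) (read-block-bits bitAt botBits t)))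

      gapsOf-encode : gapsOf symbolOf ≡ m
      gapsOf-encode = Vec-≡ λ t → begin
        lookup (gapsOf symbolOf) t                       ≡⟨ lookup∘tabulate _ t ⟩
        Mtop symbolOf (mark t) ∸ Mtop symbolOf (toℕ t)   ≡⟨ cong₂ _∸_ (Mtop-mark t) (Mtop-toℕ t) ⟩
        hi t ∸ lo t                                      ≡⟨ cong (_∸ lo t) (hi≡lo+ t) ⟩
        lo t + lookup m t ∸ lo t                         ≡⟨ m+n∸m≡n (lo t) (lookup m t) ⟩
        lookup m t                                       ∎
        where open ≡-Reasoning

  encode : (m : Vec ℕ k) → Choice m → Symbol k
  encode = Encoding.symbolOf

module _ {k : ℕ} where

  module Decoding {γ : Symbol k} (k≥1 : 1 ≤ k) (U : Unimodal γ) (Mk : Marked γ) where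
    open Unimodal U
    open Marked Mk

    lookup-gapsOf : ∀ t → lookup (gapsOf γ) t ≡ Mtop γ (mark t) ∸ Mtop γ (toℕ t)
    lookup-gapsOf = lookup∘tabulate _

    gapsOf-positive : Positive (gapsOf γ)
    gapsOf-positive t = subst (1 ≤_) (sym (lookup-gapsOf t)) (m<n⇒0<n∸m (Mtop-step U top-max top-range t))

    M-gapsOf : ∀ j → j ≤ k → M (gapsOf γ) j ≡ Mtop γ j
    M-gapsOf zero    _   = refl
    M-gapsOf (suc j) j<k = subst (λ i → M (gapsOf γ) (suc i) ≡ Mtop γ (suc i)) (toℕ-fromℕ< j<k)
      (step (fromℕ< j<k) (subst (λ i → M (gapsOf γ) i ≡ Mtop γ i) (sym (toℕ-fromℕ< j<k)) (M-gapsOf j (<⇒≤ j<k))))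
      where
      step : ∀ u → M (gapsOf γ) (toℕ u) ≡ Mtop γ (toℕ u) → M (gapsOf γ) (mark u) ≡ Mtop γ (mark u)
      step u M≡ = begin
        M (gapsOf γ) (mark u)                              ≡⟨ M-mark (gapsOf γ) u ⟩
        M (gapsOf γ) (toℕ u) + lookup (gapsOf γ) u         ≡⟨ cong₂ _+_ M≡ (lookup-gapsOf u) ⟩
        Mtop γ (toℕ u) + (Mtop γ (mark u) ∸ Mtop γ (toℕ u)) ≡⟨ m+[n∸m]≡n (<⇒≤ (Mtop-step U top-max top-range u)) ⟩
        Mtop γ (mark u)                                    ∎
        where open ≡-Reasoning

    open Blocks (gapsOf γ) using (lo; hi; offset)
    open Blocks.Positivity (gapsOf γ) gapsOf-positive using (rowOf-blocks-≡)
    open Encoding (gapsOf γ) (decode γ (gapsOf γ)) using (bitAt; topBits; botBits; topBlock; botBlock)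

    lo≡ : ∀ t → lo t ≡ Mtop γ (toℕ t)
    lo≡ t = M-gapsOf (toℕ t) (<⇒≤ (toℕ<n t))

    hi≡ : ∀ t → hi t ≡ Mtop γ (mark t)
    hi≡ t = M-gapsOf (mark t) (toℕ<n t)

    peak≡ : M (gapsOf γ) k ≡ peak γ
    peak≡ = trans (M-gapsOf k ≤-refl) (Mtop-at-k k≥1)
      where
      Mtop-at-k : 1 ≤ k → Mtop γ k ≡ peak γ
      Mtop-at-k (s≤s z≤n) = Mtop-last γ _ (n≮n _)

    inner-if-below-peak : ∀ t → hi t < peak γ → mark t < k
    inner-if-below-peak t hi<P with mark t <? k
    ... | yes t<k = t<k
    ... | no  t≮k = ⊥-elim (<-irrefl (trans (hi≡ t) (Mtop-last γ (toℕ t) t≮k)) hi<P)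

    in-ranges : ∀ {row} → InRanges γ row → ∀ {x t} → (x , t) ∈ row → lo t < x × x ≤ hi t
    in-ranges ranges {t = t} xt∈ = subst₂ (λ a b → a < _ × _ ≤ b) (sym (lo≡ t)) (sym (hi≡ t)) (ranges xt∈)

    offset∈⇔ : (row : List (ℕ × Fin k)) (t : Fin k) (i : Fin (lookup (gapsOf γ) t ∸ 1)) →
      (offset t (toℕ i) , t) ∈ row ⇔ T (lookup (readBits γ row t (lookup (gapsOf γ) t ∸ 1)) i)
    offset∈⇔ row t i = subst₂ (λ x b → (x , t) ∈ row ⇔ T b) (cong (λ l → l + 1 + toℕ i) (sym (lo≡ t)))
      (sym (lookup∘tabulate (λ j → member (Mtop γ (toℕ t) + 1 + toℕ j , t) row) i)) (⇔-sym T-member⇔)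

    top≡ : rowOf topBlock ≡ top γ
    top≡ = rowOf-blocks-≡ (top γ) top-decreasing (in-ranges top-range) (λ t → mark t <ᵇ k) hi∈⇔ topBits offset∈⇔′
      where
      hi∈⇔ : ∀ t → (hi t , t) ∈ top γ ⇔ T (mark t <ᵇ k)
      hi∈⇔ t = mk⇔ (λ hi∈ → <⇒<ᵇ (inner-if-below-peak t (proj₂ (top-bounds hi∈))))
                   (λ t<k → subst (λ h → (h , t) ∈ top γ) (sym (hi≡ t)) (top-max t (<ᵇ⇒< _ k t<k)))
      offset∈⇔′ : ∀ t i → (offset t (toℕ i) , t) ∈ top γ ⇔ T (lookup (topBits t) i)
      offset∈⇔′ t i = subst (λ v → (offset t (toℕ i) , t) ∈ top γ ⇔ T (lookup v i))
        (sym (cong proj₁ (All-tabulate⁻∘⁺ {f = id} {P = BlockBits (gapsOf γ)} (decodeBlockBits γ (gapsOf γ)) t))) (offset∈⇔ (top γ) t i)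

    bot≡ : rowOf botBlock ≡ bot γ
    bot≡ = rowOf-blocks-≡ (bot γ) bot-decreasing (in-ranges bot-range) bitAt hi∈⇔ botBits offset∈⇔′
      where
      member-hi : ∀ t → T (member (Mtop γ (mark t) , t) (bot γ)) ⇔ (hi t , t) ∈ bot γ
      member-hi t = subst (λ h → T (member (Mtop γ (mark t) , t) (bot γ)) ⇔ (h , t) ∈ bot γ) (sym (hi≡ t)) T-member⇔
      hi∈⇔ : ∀ t → (hi t , t) ∈ bot γ ⇔ T (bitAt t)
      hi∈⇔ t = subst (λ ob → (hi t , t) ∈ bot γ ⇔ T (proj₁ ob)) (sym (All-tabulate⁻∘⁺ {f = id} {P = λ t → OptionalBit (mark t <ᵇ k)} (decodeBit γ) t)) (⇔-sym (⇔-trans (T-restrict⇔ _ _) (mk⇔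
        (λ (_ , member∈) → Equivalence.to (member-hi t) member∈)
        (λ hi∈ → <⇒<ᵇ (inner-if-below-peak t (proj₂ (bot-bounds hi∈))) , Equivalence.from (member-hi t) hi∈))))
      offset∈⇔′ : ∀ t i → (offset t (toℕ i) , t) ∈ bot γ ⇔ T (lookup (botBits t) i)
      offset∈⇔′ t i = subst (λ v → (offset t (toℕ i) , t) ∈ bot γ ⇔ T (lookup v i))
        (sym (cong proj₂ (All-tabulate⁻∘⁺ {f = id} {P = BlockBits (gapsOf γ)} (decodeBlockBits γ (gapsOf γ)) t))) (offset∈⇔ (bot γ) t i)

    encode-decode : encode (gapsOf γ) (decode γ (gapsOf γ)) ≡ γ
    encode-decode = cong₂ (λ P rows → symbol P (proj₁ rows) (proj₂ rows)) peak≡ (cong₂ _,_ top≡ bot≡)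

    gapsOf≤peak : ∀ t → lookup (gapsOf γ) t ≤ peak γ
    gapsOf≤peak t = begin
      lookup (gapsOf γ) t                            ≤⟨ m≤n+m _ (M (gapsOf γ) (toℕ t)) ⟩
      M (gapsOf γ) (toℕ t) + lookup (gapsOf γ) t     ≡⟨ M-mark (gapsOf γ) t ⟨
      M (gapsOf γ) (mark t)                          ≤⟨ M-mono (gapsOf γ) (toℕ<n t) ⟩
      M (gapsOf γ) k                                 ≡⟨ peak≡ ⟩
      peak γ                                         ∎
      where open ℕ.≤-Reasoning

gaps-injective : {k n : ℕ} {u v : Vec (Fin n) k} → gaps u ≡ gaps v → u ≡ v
gaps-injective {u = []}    {[]}    _  = refl
gaps-injective {u = a ∷ u} {b ∷ v} eq =
  cong₂ _∷_ (toℕ-injective (suc-injective (∷-injectiveˡ eq))) (gaps-injective (∷-injectiveʳ eq))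

gaps-positive : {k n : ℕ} (w : Vec (Fin n) k) → Positive (gaps w)
gaps-positive w t = subst (1 ≤_) (sym (lookup-map t (suc ∘ toℕ) w)) (s≤s z≤n)

peak≤size : {k : ℕ} (γ : Symbol k) → peak γ ≤ size γ
peak≤size γ = ≤-trans (m≤m+n (peak γ) _) (m≤m+n _ _)

module _ {k : ℕ} (k≥1 : 1 ≤ k) (n : ℕ) (e : Vec ℤ k) where

  Symbols Terms : Set
  Symbols = Σ[ γ ∈ Symbol k ] (T (valid γ) × size γ ≡ n × rank γ ≡ e)
  Terms = Σ[ vc ∈ Σ (Vec (Fin n) k) (Choice ∘ gaps) ] termWeight (gaps (proj₁ vc)) (proj₂ vc) ≡ (e , n)

  module FromSymbol (γ : Symbol k) (v : T (valid γ)) (size≡n : size γ ≡ n) where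
    open Decoding k≥1 (proj₁ (Equivalence.to (valid⇔ k≥1 γ) v)) (proj₂ (Equivalence.to (valid⇔ k≥1 γ) v))
      using (gapsOf-positive; gapsOf≤peak; encode-decode)

    gap<n : ∀ t → lookup (gapsOf γ) t ∸ 1 < n
    gap<n t = <-≤-trans (pred< (gapsOf-positive t)) (≤-trans (gapsOf≤peak t) (subst (peak γ ≤_) size≡n (peak≤size γ)))
      where
      pred< : ∀ {g} → 1 ≤ g → g ∸ 1 < g
      pred< (s≤s _) = ≤-refl

    gapIndices : Vec (Fin n) k
    gapIndices = Vec.tabulate (λ t → fromℕ< (gap<n t))

    gaps-gapIndices : gaps gapIndices ≡ gapsOf γ
    gaps-gapIndices = Vec-≡ λ t → begin
      lookup (gaps gapIndices) t                  ≡⟨ lookup-map t (suc ∘ toℕ) gapIndices ⟩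
      suc (toℕ (lookup gapIndices t))             ≡⟨ cong (suc ∘ toℕ) (lookup∘tabulate _ t) ⟩
      suc (toℕ (fromℕ< (gap<n t)))                ≡⟨ cong suc (toℕ-fromℕ< (gap<n t)) ⟩
      1 + (lookup (gapsOf γ) t ∸ 1)               ≡⟨ m+[n∸m]≡n (gapsOf-positive t) ⟩
      lookup (gapsOf γ) t                         ∎
      where open ≡-Reasoning

    choice : Choice (gaps gapIndices)
    choice = decode γ (gaps gapIndices)

    encode-choice : encode (gaps gapIndices) choice ≡ γ
    encode-choice = encode-decode′ (gaps gapIndices) gaps-gapIndices
      where
      encode-decode′ : (m : Vec ℕ k) → m ≡ gapsOf γ → encode m (decode γ m) ≡ γ
      encode-decode′ _ refl = encode-decode

  symbols→terms : Symbols → Terms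
  symbols→terms (γ , v , size≡n , rank≡e) = (gapIndices , choice) , (begin
      termWeight (gaps gapIndices) choice
        ≡⟨ Encoding.weight-encode (gaps gapIndices) choice (gaps-positive gapIndices) ⟩
      (rank (encode (gaps gapIndices) choice) , size (encode (gaps gapIndices) choice))
        ≡⟨ cong (λ γ′ → rank γ′ , size γ′) encode-choice ⟩
      (rank γ , size γ)
        ≡⟨ cong₂ _,_ rank≡e size≡n ⟩
      (e , n) ∎)
    where
    open FromSymbol γ v size≡n
    open ≡-Reasoning

  encoding-weight : (((w , c) , _) : Terms) → (rank (encode (gaps w) c) , size (encode (gaps w) c)) ≡ (e , n)
  encoding-weight ((w , c) , weight≡) = trans (sym (Encoding.weight-encode (gaps w) c (gaps-positive w))) weight≡

  terms→symbols : Terms → Symbols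
  terms→symbols y@((w , c) , _) =
    encode (gaps w) c , Encoding.encode-valid (gaps w) c (gaps-positive w) k≥1 , cong proj₂ (encoding-weight y) , cong proj₁ (encoding-weight y)

  symbols↔terms : Symbols ↔ Terms
  symbols↔terms = mk↔ₛ′ symbols→terms terms→symbols to∘from from∘to
    where
    from∘to : ∀ x → terms→symbols (symbols→terms x) ≡ x
    from∘to (γ , v , size≡n , _) = symbol-≡ (FromSymbol.encode-choice γ v size≡n)
      where
      symbol-≡ : ∀ {γ′ γ : Symbol k} {p p′} → γ′ ≡ γ → _≡_ {A = Symbols} (γ′ , p′) (γ , p)
      symbol-≡ {p = v , s , r} {v′ , s′ , r′} refl = cong (_ ,_) (cong₂ _,_ (T-irrelevant v′ v) (cong₂ _,_ (uip s′ s) (uip r′ r)))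
    to∘from : ∀ y → symbols→terms (terms→symbols y) ≡ y
    to∘from y@((w , c) , _) = term-≡ (choice-≡ gapIndices (gaps-injective (trans gaps-gapIndices gapsOf-encode)))
      where
      open FromSymbol (encode (gaps w) c) (Encoding.encode-valid (gaps w) c (gaps-positive w) k≥1) (cong proj₂ (encoding-weight y))
      gapsOf-encode : gapsOf (encode (gaps w) c) ≡ gaps w
      gapsOf-encode = Encoding.gapsOf-encode (gaps w) c (gaps-positive w)
      choice-≡ : (w′ : Vec (Fin n) k) → w′ ≡ w → _≡_ {A = Σ (Vec (Fin n) k) (Choice ∘ gaps)} (w′ , decode (encode (gaps w) c) (gaps w′)) (w , c)
      choice-≡ _ refl = cong (w ,_) (Encoding.decode-encode (gaps w) c (gaps-positive w))
      term-≡ : ∀ {vc vc′ wt wt′} → vc ≡ vc′ → _≡_ {A = Terms} (vc , wt) (vc′ , wt′)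
      term-≡ {wt = wt} {wt′} refl = cong (_ ,_) (uip wt wt′)

theorem1p2 : (k : ℕ) → 1 ≤ k → (n : ℕ) → (m : Vec ℤ k) →
    (Σ[ γ ∈ Symbol k ] (T (valid γ) × size γ ≡ n × rank γ ≡ m)) ↔ Fin (coeffU k m n)
theorem1p2 k k≥1 n m = ↔-trans (symbols↔terms k≥1 n m) (↔-sym (coeff↔ m n (Utrunc k n) (Utrunc-sum n)))
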